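{- Let $p$ be a prime and let $f(x)=ax^e+p^sh(x)\in\mathbb{Q}[x]$ with $e\ge1$, $h\in\mathbb{Q}[x]$, $\nu_p(a)=0$, $\deg(h)<e$, $\nu_p(h)\ge0$ and $s\ge1$ an integer. For some $n\ge1$, assume $f^n=g_1g_2\cdots g_t$ where each $g_i\in\mathbb{Q}[x]$ is irreducible of degree $d_i\ge1$. Suppose that for every $1\le i\le t$: (i) $g_i$ is $p^{r_i}$-Dumas for some integer $r_i\ge1$; (ii) $\gcd(r_i,e)=1$; (iii) $s>\frac{r_i}{d_i}$. Then $g_1,\dots,g_t$ are all $f$-stable. In fact, for every $N\ge n$, the number of irreducible factors of $f^N$ over $\mathbb{Q}$ is exactly $t$, namely $f^N=\prod_{i=1}^t g_i\circ f^{N-n}$, and the irreducible factor $g_i\circ f^{N-n}$ is $p^{r_i}$-Dumas for each $1\le i\le t$.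
   Context: $\nu_p$ denotes the $p$-adic valuation on $\mathbb{Q}$ (with $\nu_p(0)=\infty$); for $h=\sum h_ix^i\in\mathbb{Q}[x]$, $\nu_p(h)=\min_i\nu_p(h_i)$. $f^n$ denotes the $n$-fold composition of $f$ ($f^0$ is the identity). A polynomial $q(x)=b_dx^d+\dots+b_0$ of degree $d$ is $p^{r}$-Dumas if $\nu_p(b_d)=0$, $\nu_p(b_0)=r$, $\frac{\nu_p(b_i)}{d-i}\ge\frac{r}{d}$ for $1\le i\le d-1$, and $\gcd(r,d)=1$. A polynomial $q$ is $f$-stable if $q\circ f^m$ is irreducible over $\mathbb{Q}$ for all $m\ge1$. -}

module Defs where

open import Data.Nat as ℕ using (ℕ; zero; suc; _≤_; _<_)
open import Data.Nat.Divisibility using (_∣_)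
open import Data.Nat.GCD using (gcd)
open import Data.Integer as ℤ using (ℤ; +_)
open import Data.Rational as ℚ using (ℚ; 0ℚ; 1ℚ; _/_)
open import Data.List using (List; []; _∷_; map; replicate; _++_)
open import Data.Fin using (Fin)
import Data.Fin as Fin
open import Data.Product using (Σ; ∃; _×_; _,_)
open import Data.Sum using (_⊎_)
open import Relation.Binary.PropositionalEquality using (_≡_; _≢_)
open import Relation.Nullary using (¬_)

-- Polynomials over ℚ as coefficient lists (constant term first).
-- Polynomials are compared coefficientwise (_≈P_), so trailing zeros
-- are irrelevant.

Poly : Set
Poly = List ℚ

coeff : Poly → ℕ → ℚ
coeff []      _       = 0ℚ
coeff (a ∷ q) zero    = a
coeff (a ∷ q) (suc i) = coeff q i

_≈P_ : Poly → Poly → Set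
q ≈P q' = ∀ i → coeff q i ≡ coeff q' i

infixl 6 _+P_
infixl 7 _*P_

_+P_ : Poly → Poly → Poly
[]      +P q'       = q'
(a ∷ q) +P []       = a ∷ q
(a ∷ q) +P (b ∷ q') = (a ℚ.+ b) ∷ (q +P q')

scale : ℚ → Poly → Poly
scale c q = map (c ℚ.*_) q

_*P_ : Poly → Poly → Poly
[]      *P q' = []
(a ∷ q) *P q' = scale a q' +P (0ℚ ∷ (q *P q'))

_∘P_ : Poly → Poly → Poly
[]      ∘P g = []
(a ∷ q) ∘P g = (a ∷ []) +P (g *P (q ∘P g))

X : Poly
X = 0ℚ ∷ 1ℚ ∷ []

monomial : ℚ → ℕ → Poly
monomial a e = replicate e 0ℚ ++ (a ∷ [])

iter : Poly → ℕ → Poly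
iter f zero    = X
iter f (suc n) = f ∘P iter f n

prodP : (t : ℕ) → (Fin t → Poly) → Poly
prodP zero    g = 1ℚ ∷ []
prodP (suc t) g = g Fin.zero *P prodP t (λ i → g (Fin.suc i))

Deg : Poly → ℕ → Set
Deg q d = coeff q d ≢ 0ℚ × (∀ i → d < i → coeff q i ≡ 0ℚ)

-- every coefficient of degree ≥ e vanishes, i.e. deg q < e (deg 0 = -∞)
DegLt : Poly → ℕ → Set
DegLt q e = ∀ i → e ≤ i → coeff q i ≡ 0ℚ

IsConstant : Poly → Set
IsConstant q = ∀ i → 1 ≤ i → coeff q i ≡ 0ℚ

Irreducible : Poly → Set
Irreducible q =
  (Σ ℕ λ d → Deg q d × 1 ≤ d) ×
  (∀ u w → q ≈P (u *P w) → IsConstant u ⊎ IsConstant w)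

Valℕ : ℕ → ℕ → ℕ → Set
Valℕ p m k = (p ℕ.^ k ∣ m) × ¬ (p ℕ.^ suc k ∣ m)

Val : ℕ → ℚ → ℤ → Set
Val p x v = x ≢ 0ℚ × (Σ ℕ λ a → Σ ℕ λ b →
  Valℕ p ℤ.∣ ℚ.numerator x ∣ a × Valℕ p (ℚ.denominatorℕ x) b ×
  v ≡ (+ a) ℤ.- (+ b))

-- ν_p(x) ≥ k  (with ν_p(0) = ∞)
ValGe : ℕ → ℚ → ℤ → Set
ValGe p x k = x ≡ 0ℚ ⊎ (Σ ℤ λ v → Val p x v × k ℤ.≤ v)

PolyValNonneg : ℕ → Poly → Set
PolyValNonneg p h = ∀ i → ValGe p (coeff h i) (+ 0)

Dumas : ℕ → ℕ → Poly → Set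
Dumas p r q = Σ ℕ λ d → Deg q d ×
  Val p (coeff q d) (+ 0) ×
  Val p (coeff q 0) (+ r) ×
  -- ν_p(b_i)/(d-i) ≥ r/d, i.e. d·ν_p(b_i) ≥ r·(d-i) (trivial if b_i = 0)
  (∀ i → 1 ≤ i → i < d →
     coeff q i ≡ 0ℚ ⊎
     (Σ ℤ λ v → Val p (coeff q i) v × (+ (r ℕ.* (d ℕ.∸ i))) ℤ.≤ (+ d) ℤ.* v)) ×
  gcd r d ≡ 1

Stable : Poly → Poly → Set
Stable f q = ∀ m → 1 ≤ m → Irreducible (q ∘P iter f m)

powQ : ℕ → ℕ → ℚ
powQ p s = (+ (p ℕ.^ s)) / 1

fPoly : ℕ → ℚ → ℕ → ℕ → Poly → Poly
fPoly p a e s h = monomial a e +P scale (powQ p s) h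

-- Every gᵢ ∘ fᵐ is irreducible by Dumas's criterion: a polynomial whose
-- Newton polygon at p is the single segment from (0 , r) to (d , 0) with
-- gcd(r , d) = 1 is irreducible, since the polygon of a product is the
-- Minkowski sum of the polygons of the factors and the segment has no
-- lattice point in its interior. The polygon is handled through the weight
-- d ν(bᵢ) + r i: by Gauss's lemma the first and the last index of minimal
-- weight are additive in products, and for a factor u of q the last such
-- index is the degree of u and is divisible by d, so it is 0 or d.
--
-- So it suffices that gᵢ ∘ fᵐ is again p^rᵢ-Dumas. The iterate fᵐ is
-- p-integral with unit leading coefficient, of degree eᵐ, and its polygon
-- lies above the segment from (0 , s) to (eᵐ , 0). Substituting it into gᵢ
-- stretches the segment of gᵢ horizontally by eᵐ, keeps a unit leading
-- coefficient, and, because s dᵢ > rᵢ, does not change the valuation rᵢ of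
-- the constant term; gcd(rᵢ , dᵢ eᵐ) = 1 as gcd(rᵢ , e) = 1. The
-- factorisation of fᴺ is fᴺ = fⁿ ∘ fᴺ⁻ⁿ = ∏ gᵢ ∘ fᴺ⁻ⁿ.

module Submission where

open import Data.Nat as ℕ using (ℕ)
open import Data.Nat.Primality using (Prime)
open import Data.Integer using (ℤ; +_)
open import Data.Rational using (ℚ)
open import Defs

module IntegerArithmetic where

  open import Data.Integer as ℤ using (ℤ; +_; _≤_)
  import Data.Integer.Properties as ℤ
  open import Data.Integer.Tactic.RingSolver using (solve-∀)
  open import Relation.Binary.PropositionalEquality

  i+j≤k⇒i≤k-j : ∀ {i j k} → i ℤ.+ j ≤ k → i ≤ k ℤ.- j
  i+j≤k⇒i≤k-j {i} {j} {k} i+j≤k = subst (_≤ k ℤ.- j) (cancel i j) (ℤ.+-monoˡ-≤ (ℤ.- j) i+j≤k)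
    where
    cancel : ∀ i j → i ℤ.+ j ℤ.- j ≡ i
    cancel = solve-∀

  i≤k-j⇒i+j≤k : ∀ {i j k} → i ≤ k ℤ.- j → i ℤ.+ j ≤ k
  i≤k-j⇒i+j≤k {i} {j} {k} i≤k-j = subst (i ℤ.+ j ≤_) (cancel k j) (ℤ.+-monoˡ-≤ j i≤k-j)
    where
    cancel : ∀ k j → k ℤ.- j ℤ.+ j ≡ k
    cancel = solve-∀

  0≤i⇒0≤j⇒0≤i*j : ∀ {i j} → + 0 ≤ i → + 0 ≤ j → + 0 ≤ i ℤ.* j
  0≤i⇒0≤j⇒0≤i*j {i} {j} 0≤i 0≤j =
    subst (_≤ i ℤ.* j) (ℤ.*-zeroʳ i) (ℤ.*-monoˡ-≤-nonNeg i {{ℤ.nonNegative 0≤i}} 0≤j)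

module Valuation (p : ℕ) (p-prime : Prime p) where

  open import Defs using (Valℕ; Val; powQ)
  open import Data.Nat as ℕ using (ℕ; zero; suc; _^_; NonZero; ≢-nonZero; ≢-nonZero⁻¹)
  open import Data.Nat.Base using (nonTrivial⇒n>1)
  import Data.Nat.Properties as ℕ
  open import Data.Nat.Divisibility
  open import Algebra.Properties.CommutativeSemigroup ℕ.*-commutativeSemigroup using () renaming (interchange to *-interchange)
  open import Data.Nat.Primality using (Prime; prime; euclidsLemma)
  open import Data.Integer as ℤ using (ℤ; +_; -[1+_]; +[1+_]; ∣_∣; _≤_; _<_; +≤+; -≤+)
  import Data.Integer.Properties as ℤ
  import Data.Integer.Divisibility.Signed as ℤ
  open import Data.Integer.Tactic.RingSolver using (solve-∀)
  open IntegerArithmetic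
  open import Data.Rational as ℚ using (ℚ; mkℚ; 0ℚ; 1ℚ; ↥_)
  import Data.Rational.Properties as ℚ
  import Data.Rational.Unnormalised as ℚᵘ
  import Data.Rational.Unnormalised.Properties as ℚᵘ
  open import Data.Product using (Σ; _×_; _,_; proj₁; proj₂)
  open import Data.Sum using (_⊎_; inj₁; inj₂)
  open import Data.Empty using (⊥-elim)
  open import Relation.Nullary using (¬_; yes; no)
  open import Relation.Binary.PropositionalEquality

  1<p : 1 ℕ.< p
  1<p = prime⇒1< p-prime
    where
    prime⇒1< : Prime p → 1 ℕ.< p
    prime⇒1< (prime _) = nonTrivial⇒n>1 p

  instance
    p-nonZero : NonZero p
    p-nonZero = ≢-nonZero λ p≡0 → ℕ.<⇒≢ (ℕ.<-trans ℕ.z<s 1<p) (sym p≡0)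

  pᵐ∣pⁿ : ∀ {m n} → m ℕ.≤ n → p ^ m ∣ p ^ n
  pᵐ∣pⁿ {m} {n} m≤n = divides (p ^ (n ℕ.∸ m)) (begin
    p ^ n                   ≡⟨ cong (p ^_) (ℕ.m+[n∸m]≡n m≤n) ⟨
    p ^ (m ℕ.+ (n ℕ.∸ m))   ≡⟨ ℕ.^-distribˡ-+-* p m (n ℕ.∸ m) ⟩
    p ^ m ℕ.* p ^ (n ℕ.∸ m) ≡⟨ ℕ.*-comm (p ^ m) _ ⟩
    p ^ (n ℕ.∸ m) ℕ.* p ^ m ∎)
    where open ≡-Reasoning

  -- Counts the factors p of n; the fuel only has to exceed that count.
  private
    stripP : (fuel n : ℕ) → ℕ
    stripP zero       n = 0
    stripP (suc fuel) n with p ∣? n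
    ... | yes (divides q _) = suc (stripP fuel q)
    ... | no _              = 0

  νℕ : ℕ → ℕ
  νℕ n = stripP n n

  private
    stripP-valuation : ∀ fuel n → n ≢ 0 → n ℕ.≤ fuel → Valℕ p n (stripP fuel n)
    stripP-valuation zero       n n≢0 n≤0 = ⊥-elim (n≢0 (ℕ.n≤0⇒n≡0 n≤0))
    stripP-valuation (suc fuel) n n≢0 n≤fuel with p ∣? n
    ... | no p∤n = 1∣ n , λ p∣n → p∤n (subst (_∣ n) (ℕ.*-identityʳ p) p∣n)
    ... | yes (divides q n≡q*p) = pᵏ⁺¹∣n , pᵏ⁺²∤n
      where
      n≡p*q : n ≡ p ℕ.* q
      n≡p*q = trans n≡q*p (ℕ.*-comm q p)
      q≢0 : q ≢ 0
      q≢0 q≡0 = n≢0 (trans n≡p*q (trans (cong (p ℕ.*_) q≡0) (ℕ.*-zeroʳ p)))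
      q<n : q ℕ.< n
      q<n = subst (q ℕ.<_) (sym n≡q*p) (ℕ.m<m*n q p {{≢-nonZero q≢0}} 1<p)
      ih : Valℕ p q (stripP fuel q)
      ih = stripP-valuation fuel q q≢0 (ℕ.≤-pred (ℕ.≤-trans q<n n≤fuel))
      pᵏ⁺¹∣n : p ^ suc (stripP fuel q) ∣ n
      pᵏ⁺¹∣n = subst (_ ∣_) (sym n≡p*q) (*-monoʳ-∣ p (proj₁ ih))
      pᵏ⁺²∤n : ¬ (p ^ suc (suc (stripP fuel q)) ∣ n)
      pᵏ⁺²∤n d = proj₂ ih (*-cancelˡ-∣ p (subst (_ ∣_) n≡p*q d))

  νℕ-valuation : ∀ {n} → n ≢ 0 → Valℕ p n (νℕ n)
  νℕ-valuation {n} n≢0 = stripP-valuation n n n≢0 ℕ.≤-refl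

  Valℕ⇒∣⇒≤ : ∀ {n k j} → Valℕ p n k → p ^ j ∣ n → j ℕ.≤ k
  Valℕ⇒∣⇒≤ {_} {k} {j} (_ , pᵏ⁺¹∤n) pʲ∣n with j ℕ.≤? k
  ... | yes j≤k = j≤k
  ... | no  j≰k = ⊥-elim (pᵏ⁺¹∤n (∣-trans (pᵐ∣pⁿ (ℕ.≰⇒> j≰k)) pʲ∣n))

  Valℕ⇒νℕ : ∀ {n k} → n ≢ 0 → Valℕ p n k → k ≡ νℕ n
  Valℕ⇒νℕ n≢0 v = ℕ.≤-antisym (Valℕ⇒∣⇒≤ (νℕ-valuation n≢0) (proj₁ v))
                              (Valℕ⇒∣⇒≤ v (proj₁ (νℕ-valuation n≢0)))

  pᵏ∣⇒≤νℕ : ∀ {n k} → n ≢ 0 → p ^ k ∣ n → k ℕ.≤ νℕ n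
  pᵏ∣⇒≤νℕ n≢0 = Valℕ⇒∣⇒≤ (νℕ-valuation n≢0)

  p^νℕ∣ : ∀ n → p ^ νℕ n ∣ n
  p^νℕ∣ zero    = _ ∣0
  p^νℕ∣ (suc n) = proj₁ (νℕ-valuation {suc n} λ ())

  p^[1+νℕ]∤ : ∀ {n} → n ≢ 0 → ¬ (p ^ suc (νℕ n) ∣ n)
  p^[1+νℕ]∤ n≢0 = proj₂ (νℕ-valuation n≢0)

  private
    unitPart : ∀ {n} → n ≢ 0 → Σ ℕ λ n' → n ≡ p ^ νℕ n ℕ.* n' × ¬ (p ∣ n')
    unitPart {n} n≢0 with p^νℕ∣ n
    ... | divides n' n≡n'*pᵏ = n' , n≡pᵏ*n' , p∤n'
      where
      n≡pᵏ*n' = trans n≡n'*pᵏ (ℕ.*-comm n' _)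
      p∤n' : ¬ (p ∣ n')
      p∤n' p∣n' = p^[1+νℕ]∤ n≢0
        (subst (p ^ suc (νℕ n) ∣_) (sym n≡pᵏ*n')
          (subst (_∣ p ^ νℕ n ℕ.* n') (ℕ.*-comm (p ^ νℕ n) p) (*-monoʳ-∣ (p ^ νℕ n) p∣n')))

  νℕ-* : ∀ {m n} → m ≢ 0 → n ≢ 0 → νℕ (m ℕ.* n) ≡ νℕ m ℕ.+ νℕ n
  νℕ-* {m} {n} m≢0 n≢0 = sym (Valℕ⇒νℕ mn≢0 (pᵃ⁺ᵇ∣mn , pᵃ⁺ᵇ⁺¹∤mn))
    where
    a = νℕ m
    b = νℕ n
    mn≢0 : m ℕ.* n ≢ 0
    mn≢0 mn≡0 with ℕ.m*n≡0⇒m≡0∨n≡0 m mn≡0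
    ... | inj₁ m≡0 = m≢0 m≡0
    ... | inj₂ n≡0 = n≢0 n≡0
    m' = proj₁ (unitPart m≢0)
    n' = proj₁ (unitPart n≢0)
    mn≡pᵃ⁺ᵇ*m'n' : m ℕ.* n ≡ p ^ (a ℕ.+ b) ℕ.* (m' ℕ.* n')
    mn≡pᵃ⁺ᵇ*m'n' = begin
      m ℕ.* n                           ≡⟨ cong₂ ℕ._*_ (proj₁ (proj₂ (unitPart m≢0)))
                                                        (proj₁ (proj₂ (unitPart n≢0))) ⟩
      (p ^ a ℕ.* m') ℕ.* (p ^ b ℕ.* n') ≡⟨ *-interchange (p ^ a) m' _ n' ⟩
      (p ^ a ℕ.* p ^ b) ℕ.* (m' ℕ.* n') ≡⟨ cong (ℕ._* (m' ℕ.* n')) (ℕ.^-distribˡ-+-* p a b) ⟨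
      p ^ (a ℕ.+ b) ℕ.* (m' ℕ.* n')     ∎
      where open ≡-Reasoning
    pᵃ⁺ᵇ∣mn : p ^ (a ℕ.+ b) ∣ m ℕ.* n
    pᵃ⁺ᵇ∣mn = divides (m' ℕ.* n') (trans mn≡pᵃ⁺ᵇ*m'n' (ℕ.*-comm (p ^ (a ℕ.+ b)) _))
    pᵃ⁺ᵇ⁺¹∤mn : ¬ (p ^ suc (a ℕ.+ b) ∣ m ℕ.* n)
    pᵃ⁺ᵇ⁺¹∤mn d with euclidsLemma m' n' p-prime
      (*-cancelˡ-∣ (p ^ (a ℕ.+ b)) {{ℕ.m^n≢0 p (a ℕ.+ b)}}
        (subst (_∣ p ^ (a ℕ.+ b) ℕ.* (m' ℕ.* n')) (ℕ.*-comm p (p ^ (a ℕ.+ b)))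
          (subst (p ^ suc (a ℕ.+ b) ∣_) mn≡pᵃ⁺ᵇ*m'n' d)))
    ... | inj₁ p∣m' = proj₂ (proj₂ (unitPart m≢0)) p∣m'
    ... | inj₂ p∣n' = proj₂ (proj₂ (unitPart n≢0)) p∣n'

  νℕ-pⁿ : ∀ n → νℕ (p ^ n) ≡ n
  νℕ-pⁿ n = sym (Valℕ⇒νℕ pⁿ≢0 (∣-refl , pⁿ⁺¹∤pⁿ))
    where
    instance _ = ℕ.m^n≢0 p n
    pⁿ≢0 : p ^ n ≢ 0
    pⁿ≢0 = ≢-nonZero⁻¹ (p ^ n)
    pⁿ⁺¹∤pⁿ : ¬ (p ^ suc n ∣ p ^ n)
    pⁿ⁺¹∤pⁿ d = ℕ.<⇒≱ (subst (p ^ n ℕ.<_) (ℕ.*-comm (p ^ n) p) (ℕ.m<m*n (p ^ n) p 1<p)) (∣⇒≤ d)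

  νℤ : ℤ → ℕ
  νℤ A = νℕ ∣ A ∣

  private
    ∣A∣≢0 : ∀ {A} → A ≢ + 0 → ∣ A ∣ ≢ 0
    ∣A∣≢0 A≢0 ∣A∣≡0 = A≢0 (ℤ.∣i∣≡0⇒i≡0 ∣A∣≡0)

    A*B≢0 : ∀ {A B} → A ≢ + 0 → B ≢ + 0 → A ℤ.* B ≢ + 0
    A*B≢0 {A} A≢0 B≢0 AB≡0 with ℤ.i*j≡0⇒i≡0∨j≡0 A AB≡0
    ... | inj₁ A≡0 = A≢0 A≡0
    ... | inj₂ B≡0 = B≢0 B≡0

  νℤ-* : ∀ {A B} → A ≢ + 0 → B ≢ + 0 → νℤ (A ℤ.* B) ≡ νℤ A ℕ.+ νℤ B
  νℤ-* {A} {B} A≢0 B≢0 = trans (cong νℕ (ℤ.abs-* A B)) (νℕ-* (∣A∣≢0 A≢0) (∣A∣≢0 B≢0))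

  νℤ-+ : ∀ {k A B} → A ℤ.+ B ≢ + 0 → k ≤ + νℤ A → k ≤ + νℤ B → k ≤ + νℤ (A ℤ.+ B)
  νℤ-+ { -[1+ _ ]} _       _       _       = -≤+
  νℤ-+ {+ k} {A} {B} A+B≢0 (+≤+ k≤νA) (+≤+ k≤νB) =
    +≤+ (pᵏ∣⇒≤νℕ (∣A∣≢0 A+B≢0) (ℤ.∣⇒∣ᵤ (ℤ.∣m∣n⇒∣m+n (pᵏ∣ A k≤νA) (pᵏ∣ B k≤νB))))
    where
    pᵏ∣ : ∀ C → k ℕ.≤ νℤ C → + (p ^ k) ℤ.∣ C
    pᵏ∣ C k≤νC = ℤ.∣ᵤ⇒∣ (∣-trans (pᵐ∣pⁿ k≤νC) (p^νℕ∣ ∣ C ∣))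

  -- ν is first defined on unnormalised fractions, where it is visibly a
  -- difference of valuations, and then shown to respect ≃.
  νᵘ : ℚᵘ.ℚᵘ → ℤ
  νᵘ u = + νℤ (ℚᵘ.↥ u) ℤ.- + νℕ (ℚᵘ.↧ₙ u)

  ν : ℚ → ℤ
  ν x = + νℤ (↥ x) ℤ.- + νℕ (ℚ.denominatorℕ x)

  private
    ν≡νᵘ : ∀ x → ν x ≡ νᵘ (ℚ.toℚᵘ x)
    ν≡νᵘ (mkℚ _ _ _) = refl

    ↥≢0 : ∀ {x} → x ≢ 0ℚ → ↥ x ≢ + 0
    ↥≢0 {x} x≢0 ↥x≡0 = x≢0 (ℚ.↥p≡0⇒p≡0 x ↥x≡0)

    ≢0-from-↥ : ∀ {x} → ↥ x ≢ + 0 → x ≢ 0ℚ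
    ≢0-from-↥ {x} ↥x≢0 x≡0 = ↥x≢0 (ℚ.p≡0⇒↥p≡0 x x≡0)

    ↥ᵘ≡↥ : ∀ x → ℚᵘ.↥ (ℚ.toℚᵘ x) ≡ ↥ x
    ↥ᵘ≡↥ (mkℚ _ _ _) = refl

    ↥ᵘ≢0 : ∀ {x} → x ≢ 0ℚ → ℚᵘ.↥ (ℚ.toℚᵘ x) ≢ + 0
    ↥ᵘ≢0 {x} x≢0 ↥ᵘx≡0 = ↥≢0 x≢0 (trans (sym (↥ᵘ≡↥ x)) ↥ᵘx≡0)

    [1+n]≢0 : ∀ {n} → + suc n ≢ + 0
    [1+n]≢0 ()

    difference-cong : ∀ a b c d → a ℕ.+ d ≡ c ℕ.+ b → + a ℤ.- + b ≡ + c ℤ.- + d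
    difference-cong a b c d a+d≡c+b = begin
      + a ℤ.- + b                     ≡⟨ shift (+ a) (+ b) (+ d) ⟩
      (+ a ℤ.+ + d) ℤ.- (+ b ℤ.+ + d) ≡⟨ cong (λ u → u ℤ.- (+ b ℤ.+ + d)) (ℤ.pos-+ a d) ⟨
      + (a ℕ.+ d) ℤ.- (+ b ℤ.+ + d)   ≡⟨ cong (λ u → + u ℤ.- (+ b ℤ.+ + d)) a+d≡c+b ⟩
      + (c ℕ.+ b) ℤ.- (+ b ℤ.+ + d)   ≡⟨ cong (ℤ._- (+ b ℤ.+ + d)) (ℤ.pos-+ c b) ⟩
      (+ c ℤ.+ + b) ℤ.- (+ b ℤ.+ + d) ≡⟨ unshift (+ c) (+ b) (+ d) ⟩
      + c ℤ.- + d                     ∎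
      where
      open ≡-Reasoning
      shift : ∀ a b d → a ℤ.- b ≡ (a ℤ.+ d) ℤ.- (b ℤ.+ d)
      shift = solve-∀
      unshift : ∀ c b d → (c ℤ.+ b) ℤ.- (b ℤ.+ d) ≡ c ℤ.- d
      unshift = solve-∀

    νᵘ-cong : ∀ {u v} → u ℚᵘ.≃ v → ℚᵘ.↥ u ≢ + 0 → ℚᵘ.↥ v ≢ + 0 × νᵘ u ≡ νᵘ v
    νᵘ-cong {ℚᵘ.mkℚᵘ nu du} {ℚᵘ.mkℚᵘ nv dv} (ℚᵘ.*≡* nu*dv≡nv*du) nu≢0 = nv≢0 ,
      difference-cong (νℤ nu) (νℕ (suc du)) (νℤ nv) (νℕ (suc dv)) (begin
        νℤ nu ℕ.+ νℕ (suc dv)       ≡⟨ νℤ-* nu≢0 [1+n]≢0 ⟨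
        νℤ (nu ℤ.* + suc dv)        ≡⟨ cong νℤ nu*dv≡nv*du ⟩
        νℤ (nv ℤ.* + suc du)        ≡⟨ νℤ-* nv≢0 [1+n]≢0 ⟩
        νℤ nv ℕ.+ νℕ (suc du)       ∎)
      where
      open ≡-Reasoning
      nv≢0 : nv ≢ + 0
      nv≢0 refl = A*B≢0 nu≢0 [1+n]≢0 (trans nu*dv≡nv*du (ℤ.*-zeroˡ (+ suc du)))

    viaᵘ : ∀ z {u} → u ℚᵘ.≃ ℚ.toℚᵘ z → ℚᵘ.↥ u ≢ + 0 → z ≢ 0ℚ × ν z ≡ νᵘ u
    viaᵘ z u≃z ↥u≢0 with νᵘ-cong u≃z ↥u≢0
    ... | ↥z≢0 , νᵘu≡νz = ≢0-from-↥ (λ ↥z≡0 → ↥z≢0 (trans (↥ᵘ≡↥ z) ↥z≡0)) ,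
                          trans (ν≡νᵘ z) (sym νᵘu≡νz)

  ν-* : ∀ {x y} → x ≢ 0ℚ → y ≢ 0ℚ → x ℚ.* y ≢ 0ℚ × ν (x ℚ.* y) ≡ ν x ℤ.+ ν y
  ν-* {x@(mkℚ nx dx _)} {y@(mkℚ ny dy _)} x≢0 y≢0 with
    viaᵘ (x ℚ.* y) (ℚᵘ.≃-sym (ℚ.toℚᵘ-homo-* x y)) (A*B≢0 (↥≢0 x≢0) (↥≢0 y≢0))
  ... | xy≢0 , νxy≡ = xy≢0 , (begin
    ν (x ℚ.* y)                                       ≡⟨ νxy≡ ⟩
    + νℤ (nx ℤ.* ny) ℤ.- + νℕ (suc dx ℕ.* suc dy)     ≡⟨ cong₂ (λ a b → + a ℤ.- + b)
                                                           (νℤ-* (↥≢0 x≢0) (↥≢0 y≢0))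
                                                           (νℕ-* {suc dx} {suc dy} (λ ()) (λ ())) ⟩
    + (νℤ nx ℕ.+ νℤ ny) ℤ.- + (νℕ (suc dx) ℕ.+ νℕ (suc dy))
                                                      ≡⟨ cong₂ ℤ._-_ (ℤ.pos-+ (νℤ nx) _) (ℤ.pos-+ (νℕ (suc dx)) _) ⟩
    (+ νℤ nx ℤ.+ + νℤ ny) ℤ.- (+ νℕ (suc dx) ℤ.+ + νℕ (suc dy))
                                                      ≡⟨ regroup (+ νℤ nx) (+ νℤ ny) (+ νℕ (suc dx)) (+ νℕ (suc dy)) ⟩
    ν x ℤ.+ ν y                                       ∎)
    where
    open ≡-Reasoning
    regroup : ∀ a b c d → (a ℤ.+ b) ℤ.- (c ℤ.+ d) ≡ (a ℤ.- c) ℤ.+ (b ℤ.- d)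
    regroup = solve-∀

  ν-+ : ∀ {k x y} → x ≢ 0ℚ → y ≢ 0ℚ → x ℚ.+ y ≢ 0ℚ → k ≤ ν x → k ≤ ν y → k ≤ ν (x ℚ.+ y)
  ν-+ {k} {x@(mkℚ nx dx _)} {y@(mkℚ ny dy _)} x≢0 y≢0 x+y≢0 k≤νx k≤νy =
    subst (k ≤_) (sym ν[x+y]≡) (i+j≤k⇒i≤k-j (νℤ-+ {A = A} {B} sum≢0 bound₁ bound₂))
    where
    A = nx ℤ.* + suc dy
    B = ny ℤ.* + suc dx
    bx = νℕ (suc dx)
    by = νℕ (suc dy)
    x+y≃ = ℚ.toℚᵘ-homo-+ x y
    sum≢0 : A ℤ.+ B ≢ + 0
    sum≢0 = proj₁ (νᵘ-cong x+y≃ (↥ᵘ≢0 x+y≢0))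
    ν[x+y]≡ : ν (x ℚ.+ y) ≡ + νℤ (A ℤ.+ B) ℤ.- + (bx ℕ.+ by)
    ν[x+y]≡ = trans (ν≡νᵘ (x ℚ.+ y)) (trans (proj₂ (νᵘ-cong x+y≃ (↥ᵘ≢0 x+y≢0)))
                (cong (λ b → + νℤ (A ℤ.+ B) ℤ.- + b) (νℕ-* {suc dx} {suc dy} (λ ()) (λ ()))))
    raise : ∀ {a} n b → a ≢ + 0 → k ≤ + νℤ a ℤ.- + b →
            k ℤ.+ + (b ℕ.+ νℕ (suc n)) ≤ + νℤ (a ℤ.* + suc n)
    raise {a} n b a≢0 k≤νa-b = begin
      k ℤ.+ + (b ℕ.+ c)    ≡⟨ cong (λ z → k ℤ.+ z) (ℤ.pos-+ b c) ⟩
      k ℤ.+ (+ b ℤ.+ + c)  ≡⟨ ℤ.+-assoc k (+ b) (+ c) ⟨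
      k ℤ.+ + b ℤ.+ + c    ≤⟨ ℤ.+-monoˡ-≤ (+ c) (i≤k-j⇒i+j≤k {k = + νℤ a} k≤νa-b) ⟩
      + νℤ a ℤ.+ + c       ≡⟨ ℤ.pos-+ (νℤ a) c ⟨
      + (νℤ a ℕ.+ c)       ≡⟨ cong +_ (νℤ-* a≢0 [1+n]≢0) ⟨
      + νℤ (a ℤ.* + suc n) ∎
      where
      open ℤ.≤-Reasoning
      c = νℕ (suc n)
    bound₁ : k ℤ.+ + (bx ℕ.+ by) ≤ + νℤ A
    bound₁ = raise dy bx (↥≢0 x≢0) k≤νx
    bound₂ : k ℤ.+ + (bx ℕ.+ by) ≤ + νℤ B
    bound₂ = subst (λ b → k ℤ.+ + b ≤ + νℤ B) (ℕ.+-comm by bx) (raise dx by (↥≢0 y≢0) k≤νy)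

  ν-neg : ∀ x → ν (ℚ.- x) ≡ ν x
  ν-neg (mkℚ -[1+ _ ] _ _) = refl
  ν-neg (mkℚ (+ 0)    _ _) = refl
  ν-neg (mkℚ +[1+ _ ] _ _) = refl

  -- A summand of strictly smaller valuation dominates: write x = (x + y) + (- y).
  ν-+-dominant : ∀ {x y} → x ≢ 0ℚ → (y ≡ 0ℚ ⊎ ν x < ν y) → x ℚ.+ y ≢ 0ℚ × ν (x ℚ.+ y) ≡ ν x
  ν-+-dominant {x} {y} x≢0 (inj₁ refl) = subst (λ z → z ≢ 0ℚ × ν z ≡ ν x) (sym (ℚ.+-identityʳ x)) (x≢0 , refl)
  ν-+-dominant {x} {y} x≢0 (inj₂ νx<νy) with y ℚ.≟ 0ℚ
  ... | yes refl = ν-+-dominant x≢0 (inj₁ refl)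
  ... | no  y≢0  = x+y≢0 , ℤ.≤-antisym ν[x+y]≤νx (ν-+ x≢0 y≢0 x+y≢0 ℤ.≤-refl (ℤ.<⇒≤ νx<νy))
    where
    x≡[x+y]-y : x ≡ (x ℚ.+ y) ℚ.+ ℚ.- y
    x≡[x+y]-y = begin
      x                       ≡⟨ ℚ.+-identityʳ x ⟨
      x ℚ.+ 0ℚ                ≡⟨ cong (x ℚ.+_) (ℚ.+-inverseʳ y) ⟨
      x ℚ.+ (y ℚ.+ ℚ.- y)     ≡⟨ ℚ.+-assoc x y (ℚ.- y) ⟨
      (x ℚ.+ y) ℚ.+ ℚ.- y     ∎
      where open ≡-Reasoning
    -y≢0 : ℚ.- y ≢ 0ℚ
    -y≢0 -y≡0 = y≢0 (ℚ.neg-injective -y≡0)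
    x+y≢0 : x ℚ.+ y ≢ 0ℚ
    x+y≢0 x+y≡0 = ℤ.<-irrefl (sym (trans (cong ν y≡-x) (ν-neg x))) νx<νy
      where
      y≡-x : y ≡ ℚ.- x
      y≡-x = begin
        y                    ≡⟨ ℚ.+-identityˡ y ⟨
        0ℚ ℚ.+ y             ≡⟨ cong (ℚ._+ y) (ℚ.+-inverseˡ x) ⟨
        (ℚ.- x ℚ.+ x) ℚ.+ y  ≡⟨ ℚ.+-assoc (ℚ.- x) x y ⟩
        ℚ.- x ℚ.+ (x ℚ.+ y)  ≡⟨ cong (ℚ.- x ℚ.+_) x+y≡0 ⟩
        ℚ.- x ℚ.+ 0ℚ         ≡⟨ ℚ.+-identityʳ (ℚ.- x) ⟩
        ℚ.- x                ∎
        where open ≡-Reasoning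
    ν[x+y]≤νx : ν (x ℚ.+ y) ≤ ν x
    ν[x+y]≤νx with ν (x ℚ.+ y) ℤ.≤? ν x
    ... | yes ≤ = ≤
    ... | no  ≰ = ⊥-elim (ℤ.<-irrefl refl (ℤ.suc[i]≤j⇒i<j νx≥))
      where
      νx<ν[x+y]' = ℤ.i<j⇒suc[i]≤j (ℤ.≰⇒> ≰)
      νx≥ : ℤ.suc (ν x) ≤ ν x
      νx≥ = subst (ℤ.suc (ν x) ≤_) (cong ν (sym x≡[x+y]-y))
              (ν-+ x+y≢0 -y≢0 (subst (_≢ 0ℚ) x≡[x+y]-y x≢0) νx<ν[x+y]'
                   (subst (ℤ.suc (ν x) ≤_) (sym (ν-neg y)) (ℤ.i<j⇒suc[i]≤j νx<νy)))

  Val⇒ν : ∀ {x v} → Val p x v → v ≡ ν x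
  Val⇒ν {x} (x≢0 , a , b , va , vb , v≡a-b) =
    trans v≡a-b (cong₂ (λ a b → + a ℤ.- + b) (Valℕ⇒νℕ {∣ ↥ x ∣} {a} (∣A∣≢0 (↥≢0 x≢0)) va)
                                             (Valℕ⇒νℕ {ℚ.denominatorℕ x} {b} (denominator≢0 x) vb))
    where
    denominator≢0 : ∀ z → ℚ.denominatorℕ z ≢ 0
    denominator≢0 (mkℚ _ _ _) ()

  ν⇒Val : ∀ {x} → x ≢ 0ℚ → Val p x (ν x)
  ν⇒Val {x@(mkℚ n d _)} x≢0 =
    x≢0 , νℤ n , νℕ (suc d) , νℕ-valuation (∣A∣≢0 (↥≢0 x≢0)) , νℕ-valuation (λ ()) , refl

  ν-1 : ν 1ℚ ≡ + 0
  ν-1 = cong (λ k → + k ℤ.- + k) (νℕ-pⁿ 0)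

  ν-powQ : ∀ s → powQ p s ≢ 0ℚ × ν (powQ p s) ≡ + s
  ν-powQ s with viaᵘ (powQ p s) (ℚᵘ.≃-sym (ℚ.toℚᵘ-fromℚᵘ (ℚᵘ.mkℚᵘ (+ (p ^ s)) 0))) pˢ≢0
    where
    pˢ≢0 : + (p ^ s) ≢ + 0
    pˢ≢0 pˢ≡0 = ≢-nonZero⁻¹ (p ^ s) {{ℕ.m^n≢0 p s}} (ℤ.+-injective pˢ≡0)
  ... | pˢ≢0 , νpˢ≡ =
    pˢ≢0 , trans νpˢ≡ (trans (cong₂ (λ a b → + a ℤ.- + b) (νℕ-pⁿ s) (νℕ-pⁿ 0)) (ℤ.+-identityʳ (+ s)))

module PolynomialAlgebra where

  open import Defs
  open import Algebra.Bundles using (CommutativeMonoid)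
  open import Data.Nat as ℕ using (ℕ; zero; suc)
  open import Data.Rational as ℚ using (ℚ; 0ℚ; 1ℚ)
  import Data.Rational.Properties as ℚ
  open import Algebra.Properties.CommutativeSemigroup
    (CommutativeMonoid.commutativeSemigroup ℚ.+-0-commutativeMonoid)
    using () renaming (interchange to +-interchange)
  open import Data.Fin using (Fin)
  import Data.Fin as Fin
  open import Data.List using ([]; _∷_)
  open import Data.Product using (_×_; _,_)
  open import Relation.Binary.Bundles using (Setoid)
  import Relation.Binary.Reasoning.Setoid as SetoidReasoning
  open import Relation.Binary.PropositionalEquality
  import Data.Nat.Properties as ℕ

  -- _≈P_ is a function type, from which Agda cannot recover the two
  -- polynomials; the record wrapper makes them inferable.
  infix 4 _≋_
  record _≋_ (u w : Poly) : Set where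
    constructor ⟪_⟫
    field coeff-≡ : u ≈P w
  open _≋_ public

  ≋-setoid : Setoid _ _
  ≋-setoid = record
    { Carrier       = Poly
    ; _≈_           = _≋_
    ; isEquivalence = record
      { refl  = ⟪ (λ _ → refl) ⟫
      ; sym   = λ u≋w → ⟪ (λ i → sym (coeff-≡ u≋w i)) ⟫
      ; trans = λ u≋v v≋w → ⟪ (λ i → trans (coeff-≡ u≋v i) (coeff-≡ v≋w i)) ⟫
      }
    }

  open Setoid ≋-setoid public using () renaming (refl to ≋-refl; sym to ≋-sym; trans to ≋-trans)
  module ≋-Reasoning = SetoidReasoning ≋-setoid

  coeff-+P : ∀ u w i → coeff (u +P w) i ≡ coeff u i ℚ.+ coeff w i
  coeff-+P []      w       i       = sym (ℚ.+-identityˡ (coeff w i))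
  coeff-+P (a ∷ u) []      i       = sym (ℚ.+-identityʳ (coeff (a ∷ u) i))
  coeff-+P (a ∷ u) (b ∷ w) zero    = refl
  coeff-+P (a ∷ u) (b ∷ w) (suc i) = coeff-+P u w i

  coeff-scale : ∀ c u i → coeff (scale c u) i ≡ c ℚ.* coeff u i
  coeff-scale c []      i       = sym (ℚ.*-zeroʳ c)
  coeff-scale c (a ∷ u) zero    = refl
  coeff-scale c (a ∷ u) (suc i) = coeff-scale c u i

  0∷-≋[] : ∀ {u} → u ≋ [] → (0ℚ ∷ u) ≋ []
  0∷-≋[] u≋[] = ⟪ (λ { zero → refl ; (suc i) → coeff-≡ u≋[] i }) ⟫

  ∷-cong : ∀ {a b u w} → a ≡ b → u ≋ w → (a ∷ u) ≋ (b ∷ w)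
  ∷-cong a≡b u≋w = ⟪ (λ { zero → a≡b ; (suc i) → coeff-≡ u≋w i }) ⟫

  ∷-injective : ∀ {a b u w} → (a ∷ u) ≋ (b ∷ w) → a ≡ b × u ≋ w
  ∷-injective a∷u≋b∷w = coeff-≡ a∷u≋b∷w zero , ⟪ (λ i → coeff-≡ a∷u≋b∷w (suc i)) ⟫

  tail-≋[] : ∀ {a u} → (a ∷ u) ≋ [] → u ≋ []
  tail-≋[] a∷u≋[] = ⟪ (λ i → coeff-≡ a∷u≋[] (suc i)) ⟫

  +P-cong : ∀ {u u' w w'} → u ≋ u' → w ≋ w' → u +P w ≋ u' +P w'
  +P-cong {u} {u'} {w} {w'} u≋u' w≋w' = ⟪ (λ i → begin
    coeff (u +P w) i            ≡⟨ coeff-+P u w i ⟩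
    coeff u i ℚ.+ coeff w i     ≡⟨ cong₂ ℚ._+_ (coeff-≡ u≋u' i) (coeff-≡ w≋w' i) ⟩
    coeff u' i ℚ.+ coeff w' i   ≡⟨ coeff-+P u' w' i ⟨
    coeff (u' +P w') i          ∎) ⟫
    where open ≡-Reasoning

  +P-comm : ∀ u w → u +P w ≋ w +P u
  +P-comm u w = ⟪ (λ i → trans (coeff-+P u w i)
    (trans (ℚ.+-comm (coeff u i) (coeff w i)) (sym (coeff-+P w u i)))) ⟫

  +P-identityʳ : ∀ u → u +P [] ≋ u
  +P-identityʳ u = ⟪ (λ i → trans (coeff-+P u [] i) (ℚ.+-identityʳ (coeff u i))) ⟫

  +P-interchange : ∀ a b c d → (a +P b) +P (c +P d) ≋ (a +P c) +P (b +P d)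
  +P-interchange a b c d = ⟪ (λ i → begin
    coeff ((a +P b) +P (c +P d)) i
      ≡⟨ trans (coeff-+P (a +P b) (c +P d) i) (cong₂ ℚ._+_ (coeff-+P a b i) (coeff-+P c d i)) ⟩
    (coeff a i ℚ.+ coeff b i) ℚ.+ (coeff c i ℚ.+ coeff d i)
      ≡⟨ +-interchange (coeff a i) (coeff b i) (coeff c i) (coeff d i) ⟩
    (coeff a i ℚ.+ coeff c i) ℚ.+ (coeff b i ℚ.+ coeff d i)
      ≡⟨ trans (coeff-+P (a +P c) (b +P d) i) (cong₂ ℚ._+_ (coeff-+P a c i) (coeff-+P b d i)) ⟨
    coeff ((a +P c) +P (b +P d)) i ∎) ⟫
    where open ≡-Reasoning

  0∷-+P : ∀ u w → (0ℚ ∷ u) +P (0ℚ ∷ w) ≋ 0ℚ ∷ (u +P w)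
  0∷-+P u w = ∷-cong (ℚ.+-identityˡ 0ℚ) ≋-refl

  [0]≋[] : (0ℚ ∷ []) ≋ []
  [0]≋[] = 0∷-≋[] ≋-refl

  scale-cong : ∀ c {u w} → u ≋ w → scale c u ≋ scale c w
  scale-cong c {u} {w} u≋w = ⟪ (λ i → trans (coeff-scale c u i)
    (trans (cong (c ℚ.*_) (coeff-≡ u≋w i)) (sym (coeff-scale c w i)))) ⟫

  scale-distribˡ : ∀ c u w → scale c (u +P w) ≋ scale c u +P scale c w
  scale-distribˡ c u w = ⟪ (λ i → begin
    coeff (scale c (u +P w)) i              ≡⟨ trans (coeff-scale c (u +P w) i) (cong (c ℚ.*_) (coeff-+P u w i)) ⟩
    c ℚ.* (coeff u i ℚ.+ coeff w i)         ≡⟨ ℚ.*-distribˡ-+ c (coeff u i) (coeff w i) ⟩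
    c ℚ.* coeff u i ℚ.+ c ℚ.* coeff w i     ≡⟨ trans (coeff-+P (scale c u) (scale c w) i)
                                                 (cong₂ ℚ._+_ (coeff-scale c u i) (coeff-scale c w i)) ⟨
    coeff (scale c u +P scale c w) i        ∎) ⟫
    where open ≡-Reasoning

  scale-distribʳ : ∀ a b w → scale (a ℚ.+ b) w ≋ scale a w +P scale b w
  scale-distribʳ a b w = ⟪ (λ i → trans (coeff-scale (a ℚ.+ b) w i)
    (trans (ℚ.*-distribʳ-+ (coeff w i) a b)
    (sym (trans (coeff-+P (scale a w) (scale b w) i) (cong₂ ℚ._+_ (coeff-scale a w i) (coeff-scale b w i)))))) ⟫

  scale-scale : ∀ a b w → scale a (scale b w) ≋ scale (a ℚ.* b) w
  scale-scale a b w = ⟪ (λ i → trans (coeff-scale a (scale b w) i)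
    (trans (cong (a ℚ.*_) (coeff-scale b w i))
    (trans (sym (ℚ.*-assoc a b (coeff w i))) (sym (coeff-scale (a ℚ.* b) w i))))) ⟫

  scale-zero : ∀ w → scale 0ℚ w ≋ []
  scale-zero w = ⟪ (λ i → trans (coeff-scale 0ℚ w i) (ℚ.*-zeroˡ (coeff w i))) ⟫

  scale-0∷ : ∀ c u → scale c (0ℚ ∷ u) ≋ 0ℚ ∷ scale c u
  scale-0∷ c u = ∷-cong (ℚ.*-zeroʳ c) ≋-refl

  *P-congʳ : ∀ u {w w'} → w ≋ w' → u *P w ≋ u *P w'
  *P-congʳ []      w≋w' = ≋-refl
  *P-congʳ (a ∷ u) w≋w' = +P-cong (scale-cong a w≋w') (∷-cong refl (*P-congʳ u w≋w'))

  *P-zeroˡ : ∀ {u} w → u ≋ [] → u *P w ≋ []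
  *P-zeroˡ {[]}    w u≋[] = ≋-refl
  *P-zeroˡ {a ∷ u} w a∷u≋[] = begin
    scale a w +P (0ℚ ∷ (u *P w))  ≈⟨ +P-cong (≋-trans scale-a≡0 (scale-zero w))
                                            (0∷-≋[] (*P-zeroˡ w (tail-≋[] a∷u≋[]))) ⟩
    [] +P []                      ∎
    where
    open ≋-Reasoning
    scale-a≡0 : scale a w ≋ scale 0ℚ w
    scale-a≡0 rewrite coeff-≡ a∷u≋[] zero = ≋-refl

  *P-congˡ : ∀ {u u'} w → u ≋ u' → u *P w ≋ u' *P w
  *P-congˡ {[]}    {[]}     w _ = ≋-refl
  *P-congˡ {[]}    {b ∷ u'} w []≋b∷u' = ≋-sym (*P-zeroˡ w (≋-sym []≋b∷u'))
  *P-congˡ {a ∷ u} {[]}     w a∷u≋[] = *P-zeroˡ w a∷u≋[]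
  *P-congˡ {a ∷ u} {b ∷ u'} w a∷u≋b∷u' with ∷-injective a∷u≋b∷u'
  ... | refl , u≋u' = +P-cong ≋-refl (∷-cong refl (*P-congˡ w u≋u'))

  *P-zeroʳ : ∀ u → u *P [] ≋ []
  *P-zeroʳ []      = ≋-refl
  *P-zeroʳ (a ∷ u) = 0∷-≋[] (*P-zeroʳ u)

  0∷-*P : ∀ u w → (0ℚ ∷ u) *P w ≋ 0ℚ ∷ (u *P w)
  0∷-*P u w = +P-cong (scale-zero w) ≋-refl

  [c]-*P : ∀ c w → (c ∷ []) *P w ≋ scale c w
  [c]-*P c w = ≋-trans (+P-cong ≋-refl [0]≋[]) (+P-identityʳ (scale c w))

  scale-*P : ∀ a v w → scale a v *P w ≋ scale a (v *P w)
  scale-*P a []      w = ≋-refl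
  scale-*P a (b ∷ v) w = begin
    scale (a ℚ.* b) w +P (0ℚ ∷ (scale a v *P w))   ≈⟨ +P-cong ≋-refl (∷-cong refl (scale-*P a v w)) ⟩
    scale (a ℚ.* b) w +P (0ℚ ∷ scale a (v *P w))   ≈⟨ +P-cong (scale-scale a b w) (scale-0∷ a (v *P w)) ⟨
    scale a (scale b w) +P scale a (0ℚ ∷ (v *P w)) ≈⟨ scale-distribˡ a (scale b w) (0ℚ ∷ (v *P w)) ⟨
    scale a (scale b w +P (0ℚ ∷ (v *P w)))         ∎
    where open ≋-Reasoning

  *P-scaleʳ : ∀ u a w → u *P scale a w ≋ scale a (u *P w)
  *P-scaleʳ []      a w = ≋-refl
  *P-scaleʳ (b ∷ u) a w = begin
    scale b (scale a w) +P (0ℚ ∷ (u *P scale a w))  ≈⟨ +P-cong b·a≋a·b (∷-cong refl (*P-scaleʳ u a w)) ⟩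
    scale a (scale b w) +P (0ℚ ∷ scale a (u *P w))  ≈⟨ +P-cong ≋-refl (scale-0∷ a (u *P w)) ⟨
    scale a (scale b w) +P scale a (0ℚ ∷ (u *P w))  ≈⟨ scale-distribˡ a (scale b w) (0ℚ ∷ (u *P w)) ⟨
    scale a (scale b w +P (0ℚ ∷ (u *P w)))          ∎
    where
    open ≋-Reasoning
    b·a≋a·b : scale b (scale a w) ≋ scale a (scale b w)
    b·a≋a·b = ≋-trans (scale-scale b a w)
                (≋-trans (subst (λ c → scale (b ℚ.* a) w ≋ scale c w) (ℚ.*-comm b a) ≋-refl)
                         (≋-sym (scale-scale a b w)))

  *P-distribʳ : ∀ u v w → (u +P v) *P w ≋ u *P w +P v *P w
  *P-distribʳ []      v       w = ≋-refl
  *P-distribʳ (a ∷ u) []      w = ≋-sym (+P-identityʳ ((a ∷ u) *P w))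
  *P-distribʳ (a ∷ u) (b ∷ v) w = begin
    scale (a ℚ.+ b) w +P (0ℚ ∷ ((u +P v) *P w))
      ≈⟨ +P-cong (scale-distribʳ a b w) (∷-cong refl (*P-distribʳ u v w)) ⟩
    (scale a w +P scale b w) +P (0ℚ ∷ (u *P w +P v *P w))
      ≈⟨ +P-cong ≋-refl (0∷-+P (u *P w) (v *P w)) ⟨
    (scale a w +P scale b w) +P ((0ℚ ∷ (u *P w)) +P (0ℚ ∷ (v *P w)))
      ≈⟨ +P-interchange (scale a w) (scale b w) (0ℚ ∷ (u *P w)) (0ℚ ∷ (v *P w)) ⟩
    (scale a w +P (0ℚ ∷ (u *P w))) +P (scale b w +P (0ℚ ∷ (v *P w))) ∎
    where open ≋-Reasoning

  *P-distribˡ : ∀ u v w → u *P (v +P w) ≋ u *P v +P u *P w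
  *P-distribˡ []      v w = ≋-refl
  *P-distribˡ (c ∷ u) v w = begin
    scale c (v +P w) +P (0ℚ ∷ (u *P (v +P w)))
      ≈⟨ +P-cong (scale-distribˡ c v w) (∷-cong refl (*P-distribˡ u v w)) ⟩
    (scale c v +P scale c w) +P (0ℚ ∷ (u *P v +P u *P w))
      ≈⟨ +P-cong ≋-refl (0∷-+P (u *P v) (u *P w)) ⟨
    (scale c v +P scale c w) +P ((0ℚ ∷ (u *P v)) +P (0ℚ ∷ (u *P w)))
      ≈⟨ +P-interchange (scale c v) (scale c w) (0ℚ ∷ (u *P v)) (0ℚ ∷ (u *P w)) ⟩
    (scale c v +P (0ℚ ∷ (u *P v))) +P (scale c w +P (0ℚ ∷ (u *P w))) ∎
    where open ≋-Reasoning

  *P-assoc : ∀ u v w → (u *P v) *P w ≋ u *P (v *P w)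
  *P-assoc []      v w = ≋-refl
  *P-assoc (a ∷ u) v w = begin
    (scale a v +P (0ℚ ∷ (u *P v))) *P w        ≈⟨ *P-distribʳ (scale a v) (0ℚ ∷ (u *P v)) w ⟩
    scale a v *P w +P (0ℚ ∷ (u *P v)) *P w     ≈⟨ +P-cong (scale-*P a v w) (0∷-*P (u *P v) w) ⟩
    scale a (v *P w) +P (0ℚ ∷ ((u *P v) *P w)) ≈⟨ +P-cong ≋-refl (∷-cong refl (*P-assoc u v w)) ⟩
    scale a (v *P w) +P (0ℚ ∷ (u *P (v *P w))) ∎
    where open ≋-Reasoning

  *P-identityʳ : ∀ u → u *P (1ℚ ∷ []) ≋ u
  *P-identityʳ []      = ≋-refl
  *P-identityʳ (b ∷ u) = ⟪ (λ { zero → trans (ℚ.+-identityʳ (b ℚ.* 1ℚ)) (ℚ.*-identityʳ b)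
                             ; (suc i) → coeff-≡ (*P-identityʳ u) i }) ⟫

  ∘P-zeroˡ : ∀ {u} K → u ≋ [] → u ∘P K ≋ []
  ∘P-zeroˡ {[]}    K _ = ≋-refl
  ∘P-zeroˡ {a ∷ u} K a∷u≋[] = begin
    (a ∷ []) +P (K *P (u ∘P K))  ≈⟨ +P-cong (∷-cong (coeff-≡ a∷u≋[] zero) ≋-refl)
                                            (≋-trans (*P-congʳ K (∘P-zeroˡ K (tail-≋[] a∷u≋[]))) (*P-zeroʳ K)) ⟩
    (0ℚ ∷ []) +P []              ≈⟨ +P-identityʳ (0ℚ ∷ []) ⟩
    0ℚ ∷ []                      ≈⟨ [0]≋[] ⟩
    []                           ∎
    where open ≋-Reasoning

  ∘P-congˡ : ∀ {u u'} K → u ≋ u' → u ∘P K ≋ u' ∘P K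
  ∘P-congˡ {[]}    {[]}     K _ = ≋-refl
  ∘P-congˡ {[]}    {b ∷ u'} K []≋b∷u' = ≋-sym (∘P-zeroˡ K (≋-sym []≋b∷u'))
  ∘P-congˡ {a ∷ u} {[]}     K a∷u≋[] = ∘P-zeroˡ K a∷u≋[]
  ∘P-congˡ {a ∷ u} {b ∷ u'} K a∷u≋b∷u' with ∷-injective a∷u≋b∷u'
  ... | refl , u≋u' = +P-cong ≋-refl (*P-congʳ K (∘P-congˡ K u≋u'))

  ∘P-congʳ : ∀ u {K K'} → K ≋ K' → u ∘P K ≋ u ∘P K'
  ∘P-congʳ []      K≋K' = ≋-refl
  ∘P-congʳ (a ∷ u) {K} {K'} K≋K' =
    +P-cong ≋-refl (≋-trans (*P-congˡ (u ∘P K) K≋K') (*P-congʳ K' (∘P-congʳ u K≋K')))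

  ∘P-+P : ∀ u w K → (u +P w) ∘P K ≋ u ∘P K +P w ∘P K
  ∘P-+P []      w       K = ≋-refl
  ∘P-+P (a ∷ u) []      K = ≋-sym (+P-identityʳ ((a ∷ u) ∘P K))
  ∘P-+P (a ∷ u) (b ∷ w) K = begin
    ((a ℚ.+ b) ∷ []) +P (K *P ((u +P w) ∘P K))
      ≈⟨ +P-cong ≋-refl (*P-congʳ K (∘P-+P u w K)) ⟩
    ((a ∷ []) +P (b ∷ [])) +P (K *P (u ∘P K +P w ∘P K))
      ≈⟨ +P-cong ≋-refl (*P-distribˡ K (u ∘P K) (w ∘P K)) ⟩
    ((a ∷ []) +P (b ∷ [])) +P (K *P (u ∘P K) +P K *P (w ∘P K))
      ≈⟨ +P-interchange (a ∷ []) (b ∷ []) (K *P (u ∘P K)) (K *P (w ∘P K)) ⟩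
    ((a ∷ []) +P K *P (u ∘P K)) +P ((b ∷ []) +P K *P (w ∘P K)) ∎
    where open ≋-Reasoning

  ∘P-scale : ∀ c u K → scale c u ∘P K ≋ scale c (u ∘P K)
  ∘P-scale c []      K = ≋-refl
  ∘P-scale c (a ∷ u) K = begin
    ((c ℚ.* a) ∷ []) +P (K *P (scale c u ∘P K))
      ≈⟨ +P-cong ≋-refl (≋-trans (*P-congʳ K (∘P-scale c u K)) (*P-scaleʳ K c (u ∘P K))) ⟩
    scale c (a ∷ []) +P scale c (K *P (u ∘P K))
      ≈⟨ scale-distribˡ c (a ∷ []) (K *P (u ∘P K)) ⟨
    scale c ((a ∷ []) +P (K *P (u ∘P K))) ∎
    where open ≋-Reasoning

  ∘P-const : ∀ a K → (a ∷ []) ∘P K ≋ a ∷ []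
  ∘P-const a K = ≋-trans (+P-cong ≋-refl (*P-zeroʳ K)) (+P-identityʳ (a ∷ []))

  ∘P-*P : ∀ u w K → (u *P w) ∘P K ≋ (u ∘P K) *P (w ∘P K)
  ∘P-*P []      w K = ≋-refl
  ∘P-*P (a ∷ u) w K = begin
    (scale a w +P (0ℚ ∷ (u *P w))) ∘P K
      ≈⟨ ∘P-+P (scale a w) (0ℚ ∷ (u *P w)) K ⟩
    scale a w ∘P K +P (0ℚ ∷ (u *P w)) ∘P K
      ≈⟨ +P-cong (∘P-scale a w K) (+P-cong [0]≋[] (*P-congʳ K (∘P-*P u w K))) ⟩
    scale a W +P K *P ((u ∘P K) *P W)
      ≈⟨ +P-cong ([c]-*P a W) (*P-assoc K (u ∘P K) W) ⟨
    (a ∷ []) *P W +P (K *P (u ∘P K)) *P W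
      ≈⟨ *P-distribʳ (a ∷ []) (K *P (u ∘P K)) W ⟨
    ((a ∷ []) +P K *P (u ∘P K)) *P W ∎
    where
    open ≋-Reasoning
    W = w ∘P K

  ∘P-assoc : ∀ u G K → (u ∘P G) ∘P K ≋ u ∘P (G ∘P K)
  ∘P-assoc []      G K = ≋-refl
  ∘P-assoc (b ∷ u) G K = begin
    ((b ∷ []) +P G *P (u ∘P G)) ∘P K
      ≈⟨ ∘P-+P (b ∷ []) (G *P (u ∘P G)) K ⟩
    (b ∷ []) ∘P K +P (G *P (u ∘P G)) ∘P K
      ≈⟨ +P-cong (∘P-const b K) (≋-trans (∘P-*P G (u ∘P G) K) (*P-congʳ (G ∘P K) (∘P-assoc u G K))) ⟩
    (b ∷ []) +P (G ∘P K) *P (u ∘P (G ∘P K)) ∎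
    where open ≋-Reasoning

  X-∘P : ∀ K → X ∘P K ≋ K
  X-∘P K = ≋-trans (+P-cong [0]≋[] (*P-congʳ K (∘P-const 1ℚ K))) (*P-identityʳ K)

  iter-+ : ∀ f m n → iter f (m ℕ.+ n) ≋ iter f m ∘P iter f n
  iter-+ f zero    n = ≋-sym (X-∘P (iter f n))
  iter-+ f (suc m) n = ≋-trans (∘P-congʳ f (iter-+ f m n)) (≋-sym (∘P-assoc f (iter f m) (iter f n)))

  prodP-∘P : ∀ t (g : Fin t → Poly) K → prodP t g ∘P K ≋ prodP t (λ i → g i ∘P K)
  prodP-∘P zero    g K = ∘P-const 1ℚ K
  prodP-∘P (suc t) g K = ≋-trans (∘P-*P (g Fin.zero) (prodP t (λ i → g (Fin.suc i))) K)
    (*P-congʳ (g Fin.zero ∘P K) (prodP-∘P t (λ i → g (Fin.suc i)) K))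

  coeff-*P-0 : ∀ u w → coeff (u *P w) 0 ≡ coeff u 0 ℚ.* coeff w 0
  coeff-*P-0 []      w = sym (ℚ.*-zeroˡ (coeff w 0))
  coeff-*P-0 (a ∷ u) w = trans (coeff-+P (scale a w) (0ℚ ∷ (u *P w)) 0)
                               (trans (ℚ.+-identityʳ (coeff (scale a w) 0)) (coeff-scale a w 0))

  coeff-∘P-0 : ∀ b u K → coeff ((b ∷ u) ∘P K) 0 ≡ b ℚ.+ coeff K 0 ℚ.* coeff (u ∘P K) 0
  coeff-∘P-0 b u K = trans (coeff-+P (b ∷ []) (K *P (u ∘P K)) 0) (cong (b ℚ.+_) (coeff-*P-0 K (u ∘P K)))

  coeff-monomial-< : ∀ a k i → i ℕ.< k → coeff (monomial a k) i ≡ 0ℚ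
  coeff-monomial-< a (suc k) zero    _   = refl
  coeff-monomial-< a (suc k) (suc i) i<k = coeff-monomial-< a k i (ℕ.s<s⁻¹ i<k)

  coeff-monomial-≡ : ∀ a k → coeff (monomial a k) k ≡ a
  coeff-monomial-≡ a zero    = refl
  coeff-monomial-≡ a (suc k) = coeff-monomial-≡ a k

  coeff-monomial-> : ∀ a k i → k ℕ.< i → coeff (monomial a k) i ≡ 0ℚ
  coeff-monomial-> a zero    (suc i) _   = refl
  coeff-monomial-> a (suc k) (suc i) k<i = coeff-monomial-> a k i (ℕ.s<s⁻¹ k<i)

  iter-factorisation : ∀ {f n N t g} → iter f n ≋ prodP t g → n ℕ.≤ N →
                       iter f N ≋ prodP t (λ i → g i ∘P iter f (N ℕ.∸ n))
  iter-factorisation {f} {n} {N} {t} {g} fⁿ≋∏g n≤N = begin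
    iter f N                                 ≡⟨ cong (iter f) (ℕ.m+[n∸m]≡n n≤N) ⟨
    iter f (n ℕ.+ (N ℕ.∸ n))                 ≈⟨ iter-+ f n (N ℕ.∸ n) ⟩
    iter f n ∘P iter f (N ℕ.∸ n)             ≈⟨ ∘P-congˡ (iter f (N ℕ.∸ n)) fⁿ≋∏g ⟩
    prodP t g ∘P iter f (N ℕ.∸ n)            ≈⟨ prodP-∘P t g (iter f (N ℕ.∸ n)) ⟩
    prodP t (λ i → g i ∘P iter f (N ℕ.∸ n))  ∎
    where open ≋-Reasoning

module WeightedValuation (p : ℕ) (p-prime : Prime p) (α : ℕ) (β : ℤ) where

  open Valuation p p-prime
  open PolynomialAlgebra
  open import Defs using (Poly; coeff; _+P_; _*P_; scale)
  open import Data.Nat as ℕ using (zero; suc)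
  import Data.Nat.Properties as ℕ
  open import Data.Integer as ℤ using (+_; _≤_; _<_)
  import Data.Integer.Properties as ℤ
  open import Data.Integer.Tactic.RingSolver using (solve-∀)
  open import Data.Rational as ℚ using (ℚ; 0ℚ)
  import Data.Rational.Properties as ℚ
  open import Data.List using ([]; _∷_)
  open import Data.Product using (_×_; _,_; proj₁; proj₂; map₂)
  open import Data.Sum using (_⊎_; inj₁; inj₂)
  open import Data.Empty using (⊥-elim)
  open import Relation.Nullary using (¬_; yes; no)
  open import Relation.Binary using (tri<; tri≈; tri>)
  open import Relation.Binary.PropositionalEquality

  -- The weight of the point (i , ν x) of the Newton polygon along the
  -- direction (β , α); a lower bound on the weights of all coefficients is a
  -- supporting line of the polygon.
  weight : ℚ → ℕ → ℤ
  weight x i = + α ℤ.* ν x ℤ.+ β ℤ.* + i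

  weight-mono : ∀ x y i → ν x ≤ ν y → weight x i ≤ weight y i
  weight-mono x y i νx≤νy = ℤ.+-monoˡ-≤ (β ℤ.* + i) (ℤ.*-monoˡ-≤-nonNeg (+ α) νx≤νy)

  weight-0 : ∀ x → weight x 0 ≡ + α ℤ.* ν x
  weight-0 x = trans (cong (λ z → + α ℤ.* ν x ℤ.+ z) (ℤ.*-zeroʳ β)) (ℤ.+-identityʳ (+ α ℤ.* ν x))

  weight-suc : ∀ x i → weight x (suc i) ≡ weight x i ℤ.+ β
  weight-suc x i = trans (cong (λ j → + α ℤ.* ν x ℤ.+ β ℤ.* j) (ℤ.pos-+ 1 i))
                         (regroup (+ α ℤ.* ν x) β (+ i))
    where
    regroup : ∀ a b i → a ℤ.+ b ℤ.* (+ 1 ℤ.+ i) ≡ a ℤ.+ b ℤ.* i ℤ.+ b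
    regroup = solve-∀

  weight-* : ∀ {x y} i j → x ≢ 0ℚ → y ≢ 0ℚ → weight (x ℚ.* y) (i ℕ.+ j) ≡ weight x i ℤ.+ weight y j
  weight-* {x} {y} i j x≢0 y≢0 =
    trans (cong₂ (λ v k → + α ℤ.* v ℤ.+ β ℤ.* k) (proj₂ (ν-* x≢0 y≢0)) (ℤ.pos-+ i j))
          (regroup (+ α) (ν x) (ν y) β (+ i) (+ j))
    where
    regroup : ∀ a u v b m n →
              a ℤ.* (u ℤ.+ v) ℤ.+ b ℤ.* (m ℤ.+ n) ≡ (a ℤ.* u ℤ.+ b ℤ.* m) ℤ.+ (a ℤ.* v ℤ.+ b ℤ.* n)
    regroup = solve-∀

  -- Zero coefficients lie at height ∞ and satisfy every bound.
  AtLeast : ℤ → ℚ → ℕ → Set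
  AtLeast c x i = x ≡ 0ℚ ⊎ c ≤ weight x i

  Exceeds : ℤ → ℚ → ℕ → Set
  Exceeds c = AtLeast (ℤ.suc c)

  AtLeast⇒≤ : ∀ {c x i} → AtLeast c x i → x ≢ 0ℚ → c ≤ weight x i
  AtLeast⇒≤ (inj₁ x≡0) x≢0 = ⊥-elim (x≢0 x≡0)
  AtLeast⇒≤ (inj₂ c≤w) _   = c≤w

  AtLeast-weaken : ∀ {c c' x i} → c' ≤ c → AtLeast c x i → AtLeast c' x i
  AtLeast-weaken c'≤c (inj₁ x≡0) = inj₁ x≡0
  AtLeast-weaken c'≤c (inj₂ c≤w) = inj₂ (ℤ.≤-trans c'≤c c≤w)

  Exceeds⇒AtLeast : ∀ {m x i} → Exceeds m x i → AtLeast m x i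
  Exceeds⇒AtLeast = AtLeast-weaken (ℤ.i≤suc[i] _)

  AtLeast-+ : ∀ {c x y i} → AtLeast c x i → AtLeast c y i → AtLeast c (x ℚ.+ y) i
  AtLeast-+ {c} {x} {y} {i} x≥c y≥c with x ℚ.≟ 0ℚ | y ℚ.≟ 0ℚ | x ℚ.+ y ℚ.≟ 0ℚ
  ... | yes refl | _        | _          = subst (λ z → AtLeast c z i) (sym (ℚ.+-identityˡ y)) y≥c
  ... | no _     | yes refl | _          = subst (λ z → AtLeast c z i) (sym (ℚ.+-identityʳ x)) x≥c
  ... | no _     | no _     | yes x+y≡0  = inj₁ x+y≡0
  ... | no x≢0   | no y≢0   | no x+y≢0 with ν x ℤ.≤? ν y
  ...   | yes νx≤νy = inj₂ (ℤ.≤-trans (AtLeast⇒≤ x≥c x≢0)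
                        (weight-mono x (x ℚ.+ y) i (ν-+ x≢0 y≢0 x+y≢0 ℤ.≤-refl νx≤νy)))
  ...   | no  νx≰νy = inj₂ (ℤ.≤-trans (AtLeast⇒≤ y≥c y≢0)
                        (weight-mono y (x ℚ.+ y) i (ν-+ x≢0 y≢0 x+y≢0 (ℤ.<⇒≤ (ℤ.≰⇒> νx≰νy)) ℤ.≤-refl)))

  Exceeds-+-dominant : ∀ {m x y i} → x ≢ 0ℚ → weight x i ≡ m → Exceeds m y i →
                       x ℚ.+ y ≢ 0ℚ × weight (x ℚ.+ y) i ≡ m
  Exceeds-+-dominant {m} {x} {y} {i} x≢0 refl y>m =
    map₂ (cong (λ v → + α ℤ.* v ℤ.+ β ℤ.* + i)) (ν-+-dominant x≢0 y≡0⊎νx<νy)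
    where
    y≡0⊎νx<νy : y ≡ 0ℚ ⊎ ν x < ν y
    y≡0⊎νx<νy with y ℚ.≟ 0ℚ
    ... | yes y≡0 = inj₁ y≡0
    ... | no  y≢0 with ℤ.<-cmp (ν x) (ν y)
    ...   | tri< νx<νy _ _ = inj₂ νx<νy
    ...   | tri≈ _ νx≡νy _ = ⊥-elim (ℤ.<-irrefl refl (ℤ.<-≤-trans (ℤ.suc[i]≤j⇒i<j (AtLeast⇒≤ y>m y≢0))
                                                      (weight-mono y x i (ℤ.≤-reflexive (sym νx≡νy)))))
    ...   | tri> _ _ νy<νx = ⊥-elim (ℤ.<-irrefl refl (ℤ.<-≤-trans (ℤ.suc[i]≤j⇒i<j (AtLeast⇒≤ y>m y≢0))
                                                      (weight-mono y x i (ℤ.<⇒≤ νy<νx))))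

  AtLeast-own-weight : ∀ a → AtLeast (+ α ℤ.* ν a) a 0
  AtLeast-own-weight a = inj₂ (ℤ.≤-reflexive (sym (weight-0 a)))

  AtLeast-* : ∀ {d c a x i} → AtLeast d a 0 → AtLeast c x i → AtLeast (d ℤ.+ c) (a ℚ.* x) i
  AtLeast-* {d} {c} {a} {x} {i} a≥d x≥c with a ℚ.≟ 0ℚ | x ℚ.≟ 0ℚ
  ... | yes refl | _        = inj₁ (ℚ.*-zeroˡ x)
  ... | no _     | yes refl = inj₁ (ℚ.*-zeroʳ a)
  ... | no a≢0   | no x≢0   = inj₂ (subst (d ℤ.+ c ≤_) (sym (weight-* 0 i a≢0 x≢0))
                                    (ℤ.+-mono-≤ (AtLeast⇒≤ a≥d a≢0) (AtLeast⇒≤ x≥c x≢0)))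

  Exceeds-* : ∀ {d m a x i} → AtLeast d a 0 → Exceeds m x i → Exceeds (d ℤ.+ m) (a ℚ.* x) i
  Exceeds-* {d} {m} a≥d x>m = AtLeast-weaken (ℤ.≤-reflexive (sym (sucʳ d m))) (AtLeast-* a≥d x>m)
    where
    sucʳ : ∀ d m → d ℤ.+ (+ 1 ℤ.+ m) ≡ + 1 ℤ.+ (d ℤ.+ m)
    sucʳ = solve-∀

  AtLeast-suc : ∀ {c x i} → AtLeast c x i → AtLeast (c ℤ.+ β) x (suc i)
  AtLeast-suc         (inj₁ x≡0) = inj₁ x≡0
  AtLeast-suc {x = x} {i} (inj₂ c≤w) = inj₂ (subst (_ ≤_) (sym (weight-suc x i)) (ℤ.+-monoˡ-≤ β c≤w))

  AtLeast-pred : ∀ {c x i} → AtLeast c x (suc i) → AtLeast (c ℤ.- β) x i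
  AtLeast-pred             (inj₁ x≡0) = inj₁ x≡0
  AtLeast-pred {c} {x} {i} (inj₂ c≤w) =
    inj₂ (subst (c ℤ.- β ≤_) (trans (cong (ℤ._- β) (weight-suc x i)) (cancel (weight x i) β))
                (ℤ.+-monoˡ-≤ (ℤ.- β) c≤w))
    where
    cancel : ∀ w b → w ℤ.+ b ℤ.- b ≡ w
    cancel = solve-∀

  Exceeds-suc : ∀ m {x i} → Exceeds m x i → Exceeds (m ℤ.+ β) x (suc i)
  Exceeds-suc m x>m = AtLeast-weaken (ℤ.≤-reflexive (sym (regroup m β))) (AtLeast-suc x>m)
    where
    regroup : ∀ m b → + 1 ℤ.+ m ℤ.+ b ≡ + 1 ℤ.+ (m ℤ.+ b)
    regroup = solve-∀

  Exceeds-pred : ∀ m {x i} → Exceeds m x (suc i) → Exceeds (m ℤ.- β) x i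
  Exceeds-pred m x>m = AtLeast-weaken (ℤ.≤-reflexive (sym (regroup m β))) (AtLeast-pred x>m)
    where
    regroup : ∀ m b → + 1 ℤ.+ m ℤ.- b ≡ + 1 ℤ.+ (m ℤ.- b)
    regroup = solve-∀

  record AllAtLeast (u : Poly) (c : ℤ) : Set where
    constructor allAtLeast
    field atLeast : ∀ i → AtLeast c (coeff u i) i
  open AllAtLeast public

  AllAtLeast-cong : ∀ {u w c} → u ≋ w → AllAtLeast u c → AllAtLeast w c
  AllAtLeast-cong {c = c} u≋w u≥c = allAtLeast λ i → subst (λ z → AtLeast c z i) (coeff-≡ u≋w i) (atLeast u≥c i)

  AllAtLeast-weaken : ∀ {u c c'} → c' ≤ c → AllAtLeast u c → AllAtLeast u c'
  AllAtLeast-weaken c'≤c u≥c = allAtLeast λ i → AtLeast-weaken c'≤c (atLeast u≥c i)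

  AllAtLeast-[] : ∀ c → AllAtLeast [] c
  AllAtLeast-[] c = allAtLeast λ _ → inj₁ refl

  AllAtLeast-+P : ∀ {u w c} → AllAtLeast u c → AllAtLeast w c → AllAtLeast (u +P w) c
  AllAtLeast-+P {u} {w} {c} u≥c w≥c = allAtLeast λ i →
    subst (λ z → AtLeast c z i) (sym (coeff-+P u w i)) (AtLeast-+ (atLeast u≥c i) (atLeast w≥c i))

  AllAtLeast-0∷ : ∀ {u c} → AllAtLeast u c → AllAtLeast (0ℚ ∷ u) (c ℤ.+ β)
  AllAtLeast-0∷ u≥c = allAtLeast λ { zero → inj₁ refl ; (suc i) → AtLeast-suc (atLeast u≥c i) }

  AllAtLeast-tail : ∀ {a u c} → AllAtLeast (a ∷ u) c → AllAtLeast u (c ℤ.- β)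
  AllAtLeast-tail a∷u≥c = allAtLeast λ i → AtLeast-pred (atLeast a∷u≥c (suc i))

  AllAtLeast-scale : ∀ {d c a w} → AtLeast d a 0 → AllAtLeast w c → AllAtLeast (scale a w) (d ℤ.+ c)
  AllAtLeast-scale {d} {c} {a} {w} a≥d w≥c = allAtLeast λ i →
    subst (λ z → AtLeast (d ℤ.+ c) z i) (sym (coeff-scale a w i)) (AtLeast-* a≥d (atLeast w≥c i))

  AllAtLeast-*P : ∀ {u w c₁ c₂} → AllAtLeast u c₁ → AllAtLeast w c₂ → AllAtLeast (u *P w) (c₁ ℤ.+ c₂)
  AllAtLeast-*P {[]}    _ _ = AllAtLeast-[] _
  AllAtLeast-*P {a ∷ u} {w} {c₁} {c₂} a∷u≥c₁ w≥c₂ = AllAtLeast-+P (AllAtLeast-scale (atLeast a∷u≥c₁ 0) w≥c₂)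
    (subst (AllAtLeast (0ℚ ∷ (u *P w))) (regroup c₁ β c₂)
      (AllAtLeast-0∷ (AllAtLeast-*P (AllAtLeast-tail a∷u≥c₁) w≥c₂)))
    where
    regroup : ∀ a b c → a ℤ.- b ℤ.+ c ℤ.+ b ≡ a ℤ.+ c
    regroup = solve-∀

  data End : Set where
    first last : End

  Beyond : End → ℕ → ℕ → Set
  Beyond first k i = k ℕ.< i
  Beyond last  k i = i ℕ.< k

  AtOrBeyond : End → ℕ → ℕ → Set
  AtOrBeyond first k i = k ℕ.≤ i
  AtOrBeyond last  k i = i ℕ.≤ k

  Beyond⇒AtOrBeyond : ∀ end {k i} → Beyond end k i → AtOrBeyond end k i
  Beyond⇒AtOrBeyond first = ℕ.<⇒≤
  Beyond⇒AtOrBeyond last  = ℕ.<⇒≤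

  AtOrBeyond-refl : ∀ end {i} → AtOrBeyond end i i
  AtOrBeyond-refl first = ℕ.≤-refl
  AtOrBeyond-refl last  = ℕ.≤-refl

  Beyond-suc : ∀ end {k i} → Beyond end k i → Beyond end (suc k) (suc i)
  Beyond-suc first = ℕ.s<s
  Beyond-suc last  = ℕ.s<s

  Beyond-suc⁻¹ : ∀ end {k i} → Beyond end (suc k) (suc i) → Beyond end k i
  Beyond-suc⁻¹ first = ℕ.s<s⁻¹
  Beyond-suc⁻¹ last  = ℕ.s<s⁻¹

  record Minimum (end : End) (u : Poly) (m : ℤ) (i : ℕ) : Set where
    constructor minimum
    field
      bounded  : AllAtLeast u m
      nonzero  : coeff u i ≢ 0ℚ
      attained : weight (coeff u i) i ≡ m
      beyond   : ∀ k → Beyond end k i → Exceeds m (coeff u k) k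
  open Minimum public

  FirstMinimum LastMinimum : Poly → ℤ → ℕ → Set
  FirstMinimum = Minimum first
  LastMinimum  = Minimum last

  Minimum-cong : ∀ {end u w m i} → u ≋ w → Minimum end u m i → Minimum end w m i
  Minimum-cong {m = m} {i} u≋w (minimum u≥m uᵢ≢0 w[uᵢ]≡m u>m) = minimum
    (AllAtLeast-cong u≋w u≥m)
    (subst (_≢ 0ℚ) (coeff-≡ u≋w i) uᵢ≢0)
    (trans (cong (λ z → weight z i) (sym (coeff-≡ u≋w i))) w[uᵢ]≡m)
    (λ k b → subst (λ z → Exceeds m z k) (coeff-≡ u≋w k) (u>m k b))

  Minimum-scale : ∀ {end a w n j} → a ≢ 0ℚ → Minimum end w n j → Minimum end (scale a w) (+ α ℤ.* ν a ℤ.+ n) j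
  Minimum-scale {a = a} {w} {n} {j} a≢0 (minimum w≥n wⱼ≢0 w[wⱼ]≡n w>n) = minimum
    (AllAtLeast-scale (AtLeast-own-weight a) w≥n)
    (λ awⱼ≡0 → proj₁ (ν-* a≢0 wⱼ≢0) (trans (sym (coeff-scale a w j)) awⱼ≡0))
    (begin
      weight (coeff (scale a w) j) j        ≡⟨ cong (λ z → weight z j) (coeff-scale a w j) ⟩
      weight (a ℚ.* coeff w j) (0 ℕ.+ j)    ≡⟨ weight-* 0 j a≢0 wⱼ≢0 ⟩
      weight a 0 ℤ.+ weight (coeff w j) j   ≡⟨ cong₂ ℤ._+_ (weight-0 a) w[wⱼ]≡n ⟩
      + α ℤ.* ν a ℤ.+ n                     ∎)
    (λ k b → subst (λ z → Exceeds (+ α ℤ.* ν a ℤ.+ n) z k) (sym (coeff-scale a w k))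
                   (Exceeds-* (AtLeast-own-weight a) (w>n k b)))
    where open ≡-Reasoning

  Minimum-+P : ∀ {end U V M I} → Minimum end U M I → AllAtLeast V M →
               (∀ k → AtOrBeyond end k I → Exceeds M (coeff V k) k) → Minimum end (U +P V) M I
  Minimum-+P {end} {U} {V} {M} {I} (minimum U≥M Uᵢ≢0 w[Uᵢ]≡M U>M) V≥M V>M = minimum
    (AllAtLeast-+P U≥M V≥M)
    (λ sum≡0 → proj₁ dominant (trans (sym (coeff-+P U V I)) sum≡0))
    (trans (cong (λ z → weight z I) (coeff-+P U V I)) (proj₂ dominant))
    (λ k b → subst (λ z → Exceeds M z k) (sym (coeff-+P U V k))
                   (AtLeast-+ (U>M k b) (V>M k (Beyond⇒AtOrBeyond end b))))
    where
    dominant = Exceeds-+-dominant Uᵢ≢0 w[Uᵢ]≡M (V>M I (AtOrBeyond-refl end))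

  Minimum-0∷ : ∀ {end u m i} → Minimum end u m i → Minimum end (0ℚ ∷ u) (m ℤ.+ β) (suc i)
  Minimum-0∷ {end} {u} {m} {i} (minimum u≥m uᵢ≢0 w[uᵢ]≡m u>m) = minimum
    (AllAtLeast-0∷ u≥m)
    uᵢ≢0
    (trans (weight-suc (coeff u i) i) (cong (ℤ._+ β) w[uᵢ]≡m))
    λ { zero    _ → inj₁ refl
      ; (suc k) b → Exceeds-suc m (u>m k (Beyond-suc⁻¹ end b)) }

  Minimum-tail : ∀ {end a u m i} → Minimum end (a ∷ u) m (suc i) → Minimum end u (m ℤ.- β) i
  Minimum-tail {end} {a} {u} {m} {i} (minimum a∷u≥m uᵢ≢0 w[uᵢ]≡m a∷u>m) = minimum
    (AllAtLeast-tail a∷u≥m)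
    uᵢ≢0
    (begin
      weight (coeff u i) i                 ≡⟨ cancel (weight (coeff u i) i) β ⟨
      weight (coeff u i) i ℤ.+ β ℤ.- β     ≡⟨ cong (ℤ._- β) (weight-suc (coeff u i) i) ⟨
      weight (coeff u i) (suc i) ℤ.- β     ≡⟨ cong (ℤ._- β) w[uᵢ]≡m ⟩
      m ℤ.- β                              ∎)
    (λ k b → Exceeds-pred m (a∷u>m (suc k) (Beyond-suc end b)))
    where
    open ≡-Reasoning
    cancel : ∀ w b → w ℤ.+ b ℤ.- b ≡ w
    cancel = solve-∀

  Minimum-not-beyond : ∀ {end u m m' i j} → Minimum end u m i → Minimum end u m' j → ¬ Beyond end i j
  Minimum-not-beyond {u = u} {m} {m'} {i} {j} U U' i-beyond-j = ℤ.<-irrefl refl (begin-strict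
    m'                    <⟨ ℤ.suc[i]≤j⇒i<j (AtLeast⇒≤ (beyond U' i i-beyond-j) (nonzero U)) ⟩
    weight (coeff u i) i  ≡⟨ attained U ⟩
    m                     ≤⟨ AtLeast⇒≤ (atLeast (bounded U) j) (nonzero U') ⟩
    weight (coeff u j) j  ≡⟨ attained U' ⟩
    m'                    ∎)
    where open ℤ.≤-Reasoning

  Minimum-index-unique : ∀ {end u m m' i j} → Minimum end u m i → Minimum end u m' j → i ≡ j
  Minimum-index-unique {end} {i = i} {j} U U' with ℕ.<-cmp i j | end
  ... | tri≈ _ i≡j _ | _     = i≡j
  ... | tri< i<j _ _ | first = ⊥-elim (Minimum-not-beyond U U' i<j)
  ... | tri< i<j _ _ | last  = ⊥-elim (Minimum-not-beyond U' U i<j)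
  ... | tri> _ _ j<i | first = ⊥-elim (Minimum-not-beyond U' U j<i)
  ... | tri> _ _ j<i | last  = ⊥-elim (Minimum-not-beyond U U' j<i)

  private
    shift : ∀ m n → m ℤ.- β ℤ.+ n ℤ.+ β ≡ m ℤ.+ n
    shift m n = regroup m β n
      where
      regroup : ∀ m b n → m ℤ.- b ℤ.+ n ℤ.+ b ≡ m ℤ.+ n
      regroup = solve-∀

    sucˡ : ∀ m n → + 1 ℤ.+ m ℤ.+ n ≡ + 1 ℤ.+ (m ℤ.+ n)
    sucˡ = solve-∀

  Exceeds-*P-below : ∀ {u w c n J} → AllAtLeast u c → (∀ i → i ℕ.< J → Exceeds n (coeff w i) i) →
                     ∀ i → i ℕ.< J → Exceeds (c ℤ.+ n) (coeff (u *P w) i) i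
  Exceeds-*P-below {[]}    _ _ _ _ = inj₁ refl
  Exceeds-*P-below {a ∷ u} {w} {c} {n} {J} a∷u≥c w>n i i<J =
    subst (λ z → Exceeds (c ℤ.+ n) z i) (sym (coeff-+P (scale a w) (0ℚ ∷ (u *P w)) i))
      (AtLeast-+ (subst (λ z → Exceeds (c ℤ.+ n) z i) (sym (coeff-scale a w i)) (Exceeds-* (atLeast a∷u≥c 0) (w>n i i<J)))
                 (shifted i i<J))
    where
    shifted : ∀ i → i ℕ.< J → Exceeds (c ℤ.+ n) (coeff (0ℚ ∷ (u *P w)) i) i
    shifted zero    _   = inj₁ refl
    shifted (suc i) i<J = subst (λ v → Exceeds v (coeff (u *P w) i) (suc i)) (shift c n)
      (Exceeds-suc (c ℤ.- β ℤ.+ n) (Exceeds-*P-below (AllAtLeast-tail a∷u≥c) w>n i (ℕ.<-trans (ℕ.n<1+n i) i<J)))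

  FirstMinimum-*P : ∀ u {w m n i j} → FirstMinimum u m i → FirstMinimum w n j →
                    FirstMinimum (u *P w) (m ℤ.+ n) (i ℕ.+ j)
  FirstMinimum-*P []      U _ = ⊥-elim (nonzero U refl)
  FirstMinimum-*P (a ∷ u) {w} {m} {n} {zero} {j} U W = Minimum-+P aW rest rest>
    where
    aW : FirstMinimum (scale a w) (m ℤ.+ n) j
    aW = subst (λ v → FirstMinimum (scale a w) (v ℤ.+ n) j) (trans (sym (weight-0 a)) (attained U))
               (Minimum-scale (nonzero U) W)
    rest : AllAtLeast (0ℚ ∷ (u *P w)) (m ℤ.+ n)
    rest = subst (AllAtLeast (0ℚ ∷ (u *P w))) (shift m n)
                 (AllAtLeast-0∷ (AllAtLeast-*P (AllAtLeast-tail (bounded U)) (bounded W)))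
    rest> : ∀ k → k ℕ.≤ j → Exceeds (m ℤ.+ n) (coeff (0ℚ ∷ (u *P w)) k) k
    rest> zero    _   = inj₁ refl
    rest> (suc k) k<j = subst (λ v → Exceeds v (coeff (u *P w) k) (suc k)) (shift m n)
      (Exceeds-suc (m ℤ.- β ℤ.+ n) (Exceeds-*P-below (AllAtLeast-tail (bounded U)) (beyond W) k k<j))
  FirstMinimum-*P (a ∷ u) {w} {m} {n} {suc i} {j} U W =
    Minimum-cong (+P-comm (0ℚ ∷ (u *P w)) (scale a w)) (Minimum-+P shifted aw (λ k _ → atLeast aw> k))
    where
    shifted : FirstMinimum (0ℚ ∷ (u *P w)) (m ℤ.+ n) (suc (i ℕ.+ j))
    shifted = subst (λ v → FirstMinimum (0ℚ ∷ (u *P w)) v (suc (i ℕ.+ j))) (shift m n)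
                    (Minimum-0∷ (FirstMinimum-*P u (Minimum-tail U) W))
    aw> : AllAtLeast (scale a w) (ℤ.suc (m ℤ.+ n))
    aw> = subst (AllAtLeast (scale a w)) (sucˡ m n) (AllAtLeast-scale (beyond U 0 ℕ.z<s) (bounded W))
    aw : AllAtLeast (scale a w) (m ℤ.+ n)
    aw = AllAtLeast-weaken (ℤ.i≤suc[i] _) aw>

  LastMinimum-*P : ∀ u {w m n i j} → LastMinimum u m i → LastMinimum w n j →
                   LastMinimum (u *P w) (m ℤ.+ n) (i ℕ.+ j)
  LastMinimum-*P []      U _ = ⊥-elim (nonzero U refl)
  LastMinimum-*P (a ∷ u) {w} {m} {n} {zero} {j} U W = Minimum-+P aW rest (λ k _ → atLeast rest> k)
    where
    aW : LastMinimum (scale a w) (m ℤ.+ n) j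
    aW = subst (λ v → LastMinimum (scale a w) (v ℤ.+ n) j) (trans (sym (weight-0 a)) (attained U))
               (Minimum-scale (nonzero U) W)
    u> : AllAtLeast u (ℤ.suc (m ℤ.- β))
    u> = allAtLeast λ k → AtLeast-weaken (ℤ.≤-reflexive (sym (regroup m β))) (AtLeast-pred (beyond U (suc k) ℕ.z<s))
      where
      regroup : ∀ m b → + 1 ℤ.+ m ℤ.- b ≡ + 1 ℤ.+ (m ℤ.- b)
      regroup = solve-∀
    rest> : AllAtLeast (0ℚ ∷ (u *P w)) (ℤ.suc (m ℤ.+ n))
    rest> = subst (AllAtLeast (0ℚ ∷ (u *P w))) (regroup m β n) (AllAtLeast-0∷ (AllAtLeast-*P u> (bounded W)))
      where
      regroup : ∀ m b n → + 1 ℤ.+ (m ℤ.- b) ℤ.+ n ℤ.+ b ≡ + 1 ℤ.+ (m ℤ.+ n)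
      regroup = solve-∀
    rest : AllAtLeast (0ℚ ∷ (u *P w)) (m ℤ.+ n)
    rest = AllAtLeast-weaken (ℤ.i≤suc[i] _) rest>
  LastMinimum-*P (a ∷ u) {w} {m} {n} {suc i} {j} U W =
    Minimum-cong (+P-comm (0ℚ ∷ (u *P w)) (scale a w)) (Minimum-+P shifted aw aw>)
    where
    shifted : LastMinimum (0ℚ ∷ (u *P w)) (m ℤ.+ n) (suc (i ℕ.+ j))
    shifted = subst (λ v → LastMinimum (0ℚ ∷ (u *P w)) v (suc (i ℕ.+ j))) (shift m n)
                    (Minimum-0∷ (LastMinimum-*P u (Minimum-tail U) W))
    aw : AllAtLeast (scale a w) (m ℤ.+ n)
    aw = AllAtLeast-scale (atLeast (bounded U) 0) (bounded W)
    aw> : ∀ k → suc (i ℕ.+ j) ℕ.≤ k → Exceeds (m ℤ.+ n) (coeff (scale a w) k) k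
    aw> k i+j<k = subst (λ z → Exceeds (m ℤ.+ n) z k) (sym (coeff-scale a w k))
      (Exceeds-* (atLeast (bounded U) 0) (beyond W k (ℕ.≤-trans (ℕ.s≤s (ℕ.m≤n+m j i)) i+j<k)))

  record Minimisers (u : Poly) : Set where
    constructor minimisers
    field
      minWeight             : ℤ
      firstIndex lastIndex  : ℕ
      isFirst               : FirstMinimum u minWeight firstIndex
      isLast                : LastMinimum u minWeight lastIndex

  private
    FirstMinimum-head : ∀ {a u M} → a ≢ 0ℚ → weight a 0 ≡ M → AllAtLeast (0ℚ ∷ u) M → FirstMinimum (a ∷ u) M 0
    FirstMinimum-head a≢0 w[a]≡M u≥M = minimum
      (allAtLeast λ { zero → inj₂ (ℤ.≤-reflexive (sym w[a]≡M)) ; (suc i) → atLeast u≥M (suc i) })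
      a≢0 w[a]≡M (λ _ ())

    LastMinimum-head : ∀ {a u M} → a ≢ 0ℚ → weight a 0 ≡ M → AllAtLeast (0ℚ ∷ u) (ℤ.suc M) →
                       LastMinimum (a ∷ u) M 0
    LastMinimum-head a≢0 w[a]≡M u>M = minimum
      (allAtLeast λ { zero → inj₂ (ℤ.≤-reflexive (sym w[a]≡M)) ; (suc i) → Exceeds⇒AtLeast (atLeast u>M (suc i)) })
      a≢0 w[a]≡M (λ { (suc i) _ → atLeast u>M (suc i) })

    FirstMinimum-∷ : ∀ {a u M I} → FirstMinimum (0ℚ ∷ u) M (suc I) → Exceeds M a 0 → FirstMinimum (a ∷ u) M (suc I)
    FirstMinimum-∷ (minimum u≥M uᵢ≢0 w[uᵢ]≡M u>M) a>M = minimum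
      (allAtLeast λ { zero → Exceeds⇒AtLeast a>M ; (suc i) → atLeast u≥M (suc i) })
      uᵢ≢0 w[uᵢ]≡M (λ { zero _ → a>M ; (suc k) k<I → u>M (suc k) k<I })

    LastMinimum-∷ : ∀ {a u M I} → LastMinimum (0ℚ ∷ u) M (suc I) → AtLeast M a 0 → LastMinimum (a ∷ u) M (suc I)
    LastMinimum-∷ (minimum u≥M uᵢ≢0 w[uᵢ]≡M u>M) a≥M = minimum
      (allAtLeast λ { zero → a≥M ; (suc i) → atLeast u≥M (suc i) })
      uᵢ≢0 w[uᵢ]≡M (λ { (suc k) I<k → u>M (suc k) I<k })

  findMinimisers : ∀ u → u ≋ [] ⊎ Minimisers u
  findMinimisers []      = inj₁ ≋-refl
  findMinimisers (a ∷ u) with findMinimisers u | a ℚ.≟ 0ℚ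
  ... | inj₁ u≋[] | yes refl = inj₁ (0∷-≋[] u≋[])
  ... | inj₁ u≋[] | no  a≢0  =
    inj₂ (minimisers (weight a 0) 0 0 (FirstMinimum-head a≢0 refl tail≥) (LastMinimum-head a≢0 refl tail≥))
    where
    tail≥ : ∀ {c} → AllAtLeast (0ℚ ∷ u) c
    tail≥ = allAtLeast λ { zero → inj₁ refl ; (suc i) → inj₁ (coeff-≡ u≋[] i) }
  ... | inj₂ (minimisers m i j U U') | yes refl =
    inj₂ (minimisers (m ℤ.+ β) (suc i) (suc j) (Minimum-0∷ U) (Minimum-0∷ U'))
  ... | inj₂ (minimisers m i j U U') | no a≢0 with ℤ.<-cmp (weight a 0) (m ℤ.+ β)
  ...   | tri< a<u _ _ = inj₂ (minimisers (weight a 0) 0 0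
            (FirstMinimum-head a≢0 refl (AllAtLeast-weaken (ℤ.<⇒≤ a<u) (AllAtLeast-0∷ (bounded U))))
            (LastMinimum-head a≢0 refl (AllAtLeast-weaken (ℤ.i<j⇒suc[i]≤j a<u) (AllAtLeast-0∷ (bounded U)))))
  ...   | tri≈ _ a≈u _ = inj₂ (minimisers (m ℤ.+ β) 0 (suc j)
            (FirstMinimum-head a≢0 a≈u (AllAtLeast-0∷ (bounded U)))
            (LastMinimum-∷ (Minimum-0∷ U') (inj₂ (ℤ.≤-reflexive (sym a≈u)))))
  ...   | tri> _ _ u<a = inj₂ (minimisers (m ℤ.+ β) (suc i) (suc j)
            (FirstMinimum-∷ (Minimum-0∷ U) (inj₂ (ℤ.i<j⇒suc[i]≤j u<a)))
            (LastMinimum-∷ (Minimum-0∷ U') (inj₂ (ℤ.<⇒≤ u<a))))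

  minimisersOf : ∀ u → ¬ (u ≋ []) → Minimisers u
  minimisersOf u u≉[] with findMinimisers u
  ... | inj₁ u≋[] = ⊥-elim (u≉[] u≋[])
  ... | inj₂ M    = M

-- The outer polynomial q is weighed with (α , φ), the inner one F and the
-- composite q ∘ F with (α , β): a power Fᵏ has (α , β)-weight k φ when φ is
-- the minimal weight of F, exactly as xᵏ has (α , φ)-weight k φ.
module Composition (p : ℕ) (p-prime : Prime p) (α : ℕ) (φ β : ℤ) where

  open import Defs using (coeff; _∘P_; _*P_)
  open PolynomialAlgebra
  open import Data.Nat as ℕ using (zero; suc)
  import Data.Nat.Properties as ℕ
  open import Data.Integer as ℤ using (+_; _≤_)
  import Data.Integer.Properties as ℤ
  open import Data.Integer.Tactic.RingSolver using (solve-∀)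
  open import Data.List using ([]; _∷_)
  open import Data.Sum using (inj₁; inj₂)
  open import Data.Empty using (⊥-elim)
  open import Relation.Binary.PropositionalEquality

  module Outer = WeightedValuation p p-prime α φ
  module Inner = WeightedValuation p p-prime α β

  private
    weight-0-agrees : ∀ b → Outer.weight b 0 ≡ Inner.weight b 0
    weight-0-agrees b = trans (Outer.weight-0 b) (sym (Inner.weight-0 b))

    AtLeast-0 : ∀ {c b} → Outer.AtLeast c b 0 → Inner.AtLeast c b 0
    AtLeast-0 (inj₁ b≡0) = inj₁ b≡0
    AtLeast-0 {c} {b} (inj₂ c≤w) = inj₂ (subst (c ≤_) (weight-0-agrees b) c≤w)

    AllAtLeast-const : ∀ {b c} → Inner.AtLeast c b 0 → Inner.AllAtLeast (b ∷ []) c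
    AllAtLeast-const b≥c = Inner.allAtLeast λ { zero → b≥c ; (suc i) → inj₁ refl }

    φ+[c-φ] : ∀ c → φ ℤ.+ (c ℤ.- φ) ≡ c
    φ+[c-φ] c = cancel φ c
      where
      cancel : ∀ f c → f ℤ.+ (c ℤ.- f) ≡ c
      cancel = solve-∀

  AllAtLeast-∘P : ∀ q {F c} → Outer.AllAtLeast q c → Inner.AllAtLeast F φ → Inner.AllAtLeast (q ∘P F) c
  AllAtLeast-∘P []      _ _ = Inner.AllAtLeast-[] _
  AllAtLeast-∘P (b ∷ q) {F} {c} b∷q≥c F≥φ = Inner.AllAtLeast-+P
    (AllAtLeast-const (AtLeast-0 (Outer.atLeast b∷q≥c 0)))
    (subst (Inner.AllAtLeast (F *P (q ∘P F))) (φ+[c-φ] c)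
           (Inner.AllAtLeast-*P F≥φ (AllAtLeast-∘P q (Outer.AllAtLeast-tail b∷q≥c) F≥φ)))

  LastMinimum-∘P : ∀ q {F M d E} → 1 ℕ.≤ E → Outer.LastMinimum q M d → Inner.LastMinimum F φ E →
                   Inner.LastMinimum (q ∘P F) M (d ℕ.* E)
  LastMinimum-∘P []      _ Q _ = ⊥-elim (Outer.nonzero Q refl)
  LastMinimum-∘P (b ∷ q) {F} {M} {zero} {E} _ Q F* = Inner.Minimum-+P b* FqF≥M (λ k _ → Inner.atLeast FqF>M k)
    where
    b* : Inner.LastMinimum (b ∷ []) M 0
    b* = Inner.minimum
      (AllAtLeast-const (inj₂ (ℤ.≤-reflexive (trans (sym (Outer.attained Q)) (weight-0-agrees b)))))
      (Outer.nonzero Q)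
      (trans (sym (weight-0-agrees b)) (Outer.attained Q))
      (λ { (suc i) _ → inj₁ refl })
    q>M : Outer.AllAtLeast q (ℤ.suc (M ℤ.- φ))
    q>M = Outer.allAtLeast λ i →
      Outer.AtLeast-weaken (ℤ.≤-reflexive (sym (regroup M φ))) (Outer.AtLeast-pred (Outer.beyond Q (suc i) ℕ.z<s))
      where
      regroup : ∀ m f → + 1 ℤ.+ m ℤ.- f ≡ + 1 ℤ.+ (m ℤ.- f)
      regroup = solve-∀
    FqF>M : Inner.AllAtLeast (F *P (q ∘P F)) (ℤ.suc M)
    FqF>M = subst (Inner.AllAtLeast (F *P (q ∘P F))) (regroup φ M)
                  (Inner.AllAtLeast-*P (Inner.bounded F*) (AllAtLeast-∘P q q>M (Inner.bounded F*)))
      where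
      regroup : ∀ f m → f ℤ.+ (+ 1 ℤ.+ (m ℤ.- f)) ≡ + 1 ℤ.+ m
      regroup = solve-∀
    FqF≥M : Inner.AllAtLeast (F *P (q ∘P F)) M
    FqF≥M = Inner.AllAtLeast-weaken (ℤ.i≤suc[i] M) FqF>M
  LastMinimum-∘P (b ∷ q) {F} {M} {suc d} {E} 1≤E Q F* =
    Inner.Minimum-cong (+P-comm (F *P (q ∘P F)) (b ∷ [])) (Inner.Minimum-+P FqF* b≥M b>M)
    where
    FqF* : Inner.LastMinimum (F *P (q ∘P F)) M (E ℕ.+ d ℕ.* E)
    FqF* = subst (λ m → Inner.LastMinimum (F *P (q ∘P F)) m (E ℕ.+ d ℕ.* E)) (φ+[c-φ] M)
                 (Inner.LastMinimum-*P F F* (LastMinimum-∘P q 1≤E (Outer.Minimum-tail Q) F*))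
    b≥M : Inner.AllAtLeast (b ∷ []) M
    b≥M = AllAtLeast-const (AtLeast-0 (Outer.atLeast (Outer.bounded Q) 0))
    b>M : ∀ k → E ℕ.+ d ℕ.* E ℕ.≤ k → Inner.Exceeds M (coeff (b ∷ []) k) k
    b>M zero    E+dE≤0 = ⊥-elim (ℕ.<⇒≱ (ℕ.<-≤-trans 1≤E (ℕ.m≤m+n E (d ℕ.* E))) E+dE≤0)
    b>M (suc k) _      = inj₁ refl

module Degree (p : ℕ) (p-prime : Prime p) where

  open import Defs using (Poly; coeff; Deg; IsConstant; _*P_)
  open PolynomialAlgebra using (_≋_; coeff-≡)
  open Valuation p p-prime using (ν)
  import Data.Nat as ℕ
  import Data.Nat.Properties as ℕ
  open import Data.Integer as ℤ using (ℤ; +_; -1ℤ; _≤_; +≤+)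
  import Data.Integer.Properties as ℤ
  open import Data.Rational using (0ℚ)
  open import Data.List using ([])
  open import Data.Product using (Σ; _,_)
  open import Data.Sum using (_⊎_; inj₁; inj₂)
  open import Data.Empty using (⊥-elim)
  open import Relation.Nullary using (¬_; yes; no)
  open import Relation.Binary using (tri<; tri≈; tri>)
  open import Relation.Binary.PropositionalEquality

  -- With α = 0 the weight only sees positions, so the last minimiser for a
  -- negative slope is the degree; with α = 1 it also sees valuations.
  module Position (β : ℤ) = WeightedValuation p p-prime 0 β
  module Height   (β : ℤ) = WeightedValuation p p-prime 1 β

  Position-weight : ∀ β x i → Position.weight β x i ≡ β ℤ.* + i
  Position-weight β x i = ℤ.+-identityˡ (β ℤ.* + i)

  Deg-unique : ∀ {u d d'} → Deg u d → Deg u d' → d ≡ d'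
  Deg-unique {d = d} {d'} (u_d≢0 , u>d≡0) (u_d'≢0 , u>d'≡0) with ℕ.<-cmp d d'
  ... | tri< d<d' _ _ = ⊥-elim (u_d'≢0 (u>d≡0 d' d<d'))
  ... | tri≈ _ d≡d' _ = d≡d'
  ... | tri> _ _ d'<d = ⊥-elim (u_d≢0 (u>d'≡0 d d'<d))

  Deg⇒LastMinimum : ∀ {u d} β → β ≤ + 0 → Deg u d → Position.LastMinimum β u (β ℤ.* + d) d
  Deg⇒LastMinimum {u} {d} β β≤0 (u_d≢0 , u>d≡0) = Position.minimum
    (Position.allAtLeast bound)
    u_d≢0
    (Position-weight β (coeff u d) d)
    (λ k d<k → inj₁ (u>d≡0 k d<k))
    where
    bound : ∀ i → Position.AtLeast β (β ℤ.* + d) (coeff u i) i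
    bound i with i ℕ.≤? d
    ... | no  i≰d = inj₁ (u>d≡0 i (ℕ.≰⇒> i≰d))
    ... | yes i≤d = inj₂ (subst (β ℤ.* + d ≤_) (sym (Position-weight β (coeff u i) i))
                                (ℤ.*-monoˡ-≤-nonPos β {{ℤ.nonPositive β≤0}} (+≤+ i≤d)))

  LastMinimum⇒Deg : ∀ {u m d} → Position.LastMinimum -1ℤ u m d → Deg u d
  LastMinimum⇒Deg {u} {m} {d} U = Position.nonzero U , beyond-zero
    where
    beyond-zero : ∀ i → d ℕ.< i → coeff u i ≡ 0ℚ
    beyond-zero i d<i with Position.beyond U i d<i
    ... | inj₁ u_i≡0 = u_i≡0
    ... | inj₂ m<w = ⊥-elim (ℕ.<⇒≯ d<i (ℤ.drop‿+<+ (ℤ.*-cancelˡ-<-nonPos -1ℤ (begin-strict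
      -1ℤ ℤ.* + d                            ≡⟨ Position-weight -1ℤ (coeff u d) d ⟨
      Position.weight -1ℤ (coeff u d) d      ≡⟨ Position.attained U ⟩
      m                                      <⟨ ℤ.suc[i]≤j⇒i<j m<w ⟩
      Position.weight -1ℤ (coeff u i) i      ≡⟨ Position-weight -1ℤ (coeff u i) i ⟩
      -1ℤ ℤ.* + i                            ∎))))
      where open ℤ.≤-Reasoning

  Integral : Poly → Set
  Integral u = Height.AllAtLeast (+ 0) u (+ 0)

  Integral⇒ν≥0 : ∀ {u} → Integral u → ∀ i → coeff u i ≡ 0ℚ ⊎ + 0 ≤ ν (coeff u i)
  Integral⇒ν≥0 {u} u-integral i with Height.atLeast u-integral i
  ... | inj₁ u_i≡0 = inj₁ u_i≡0
  ... | inj₂ 0≤w = inj₂ (subst (+ 0 ≤_) (trans (ℤ.+-identityʳ _) (ℤ.*-identityˡ (ν (coeff u i))))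
                             (subst (λ z → + 0 ≤ + 1 ℤ.* ν (coeff u i) ℤ.+ z) (ℤ.*-zeroˡ (+ i)) 0≤w))

  ν≥0⇒Integral : ∀ {u} → (∀ i → coeff u i ≡ 0ℚ ⊎ + 0 ≤ ν (coeff u i)) → Integral u
  ν≥0⇒Integral {u} ν≥0 = Height.allAtLeast bound
    where
    bound : ∀ i → Height.AtLeast (+ 0) (+ 0) (coeff u i) i
    bound i with ν≥0 i
    ... | inj₁ u_i≡0 = inj₁ u_i≡0
    ... | inj₂ 0≤ν = inj₂ (subst (λ z → + 0 ≤ + 1 ℤ.* ν (coeff u i) ℤ.+ z) (sym (ℤ.*-zeroˡ (+ i)))
                           (subst (+ 0 ≤_) (sym (trans (ℤ.+-identityʳ _) (ℤ.*-identityˡ (ν (coeff u i))))) 0≤ν))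

  Integral⇒LastMinimum : ∀ {u d} β → β ≤ + 0 → Deg u d → ν (coeff u d) ≡ + 0 → Integral u →
                          Height.LastMinimum β u (β ℤ.* + d) d
  Integral⇒LastMinimum {u} {d} β β≤0 (u_d≢0 , u>d≡0) ν[u_d]≡0 u-integral = Height.minimum
    (Height.allAtLeast bound)
    u_d≢0
    (trans (cong (λ v → + 1 ℤ.* v ℤ.+ β ℤ.* + d) ν[u_d]≡0) (ℤ.+-identityˡ (β ℤ.* + d)))
    (λ k d<k → inj₁ (u>d≡0 k d<k))
    where
    bound : ∀ i → Height.AtLeast β (β ℤ.* + d) (coeff u i) i
    bound i with i ℕ.≤? d | Integral⇒ν≥0 u-integral i
    ... | no  i≰d | _          = inj₁ (u>d≡0 i (ℕ.≰⇒> i≰d))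
    ... | yes _   | inj₁ u_i≡0 = inj₁ u_i≡0
    ... | yes i≤d | inj₂ 0≤ν   = inj₂ (begin
      β ℤ.* + d                      ≤⟨ ℤ.*-monoˡ-≤-nonPos β {{ℤ.nonPositive β≤0}} (+≤+ i≤d) ⟩
      β ℤ.* + i                      ≡⟨ ℤ.+-identityˡ (β ℤ.* + i) ⟨
      + 0 ℤ.+ β ℤ.* + i              ≤⟨ ℤ.+-monoˡ-≤ (β ℤ.* + i) 0≤ν ⟩
      ν (coeff u i) ℤ.+ β ℤ.* + i    ≡⟨ cong (ℤ._+ β ℤ.* + i) (ℤ.*-identityˡ (ν (coeff u i))) ⟨
      Height.weight β (coeff u i) i  ∎)
      where open ℤ.≤-Reasoning

  Deg-cong : ∀ {u w d} → u ≋ w → Deg u d → Deg w d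
  Deg-cong {d = d} u≋w (u_d≢0 , u>d≡0) =
    subst (_≢ 0ℚ) (coeff-≡ u≋w d) u_d≢0 , λ i d<i → trans (sym (coeff-≡ u≋w i)) (u>d≡0 i d<i)

  Deg-exists : ∀ u → ¬ (u ≋ []) → Σ ℕ (Deg u)
  Deg-exists u u≉[] = _ , LastMinimum⇒Deg (Position.Minimisers.isLast (Position.minimisersOf -1ℤ u u≉[]))

  Deg-*P : ∀ {u w a b} → Deg u a → Deg w b → Deg (u *P w) (a ℕ.+ b)
  Deg-*P {u} {w} {a} {b} deg-u deg-w = LastMinimum⇒Deg
    (Position.LastMinimum-*P -1ℤ u (Deg⇒LastMinimum -1ℤ ℤ.-≤+ deg-u) (Deg⇒LastMinimum -1ℤ ℤ.-≤+ deg-w))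

  Deg⇒≤ : ∀ {u d i} → Deg u d → coeff u i ≢ 0ℚ → i ℕ.≤ d
  Deg⇒≤ {_} {d} {i} (_ , u>d≡0) u_i≢0 with i ℕ.≤? d
  ... | yes i≤d = i≤d
  ... | no  i≰d = ⊥-elim (u_i≢0 (u>d≡0 i (ℕ.≰⇒> i≰d)))

  Deg0⇒IsConstant : ∀ {u} → Deg u 0 → IsConstant u
  Deg0⇒IsConstant (_ , u>0≡0) i 1≤i = u>0≡0 i 1≤i

module Composites (p : ℕ) (p-prime : Prime p) where

  open import Defs using (Poly; coeff; Deg; _∘P_)
  open import Data.Rational using (0ℚ)
  open Valuation p p-prime using (ν)
  open Degree p p-prime
  import Data.Nat as ℕ
  import Data.Nat.Properties as ℕ
  open import Data.Integer as ℤ using (ℤ; +_; -1ℤ; _≤_; +≤+; -≤+)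
  import Data.Integer.Properties as ℤ
  open import Data.Integer.Tactic.RingSolver using (solve-∀)
  open IntegerArithmetic using (0≤i⇒0≤j⇒0≤i*j)
  open import Data.Product using (_,_; proj₂)
  open import Data.Sum using (_⊎_; inj₁; inj₂)
  open import Relation.Nullary using (yes; no)
  open import Relation.Binary using (tri<; tri≈; tri>)
  open import Relation.Binary.PropositionalEquality

  -- u is p-integral of degree d with a p-adic unit as leading coefficient,
  -- i.e. its reduction mod p still has degree d.
  record IntegralWithUnitLead (u : Poly) (d : ℕ) : Set where
    field
      degree   : Deg u d
      unitLead : ν (coeff u d) ≡ + 0
      integral : Integral u
  open IntegralWithUnitLead public

  private
    -E≤0 : ∀ E → -1ℤ ℤ.* + E ≤ + 0
    -E≤0 E = subst (-1ℤ ℤ.* + E ≤_) (ℤ.*-zeroˡ (+ E)) (ℤ.*-monoʳ-≤-nonNeg (+ E) (-≤+ {m = 0} {n = 0}))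

  IntegralWithUnitLead-∘P : ∀ {q F d E} → 1 ℕ.≤ E → IntegralWithUnitLead q d → IntegralWithUnitLead F E →
                            IntegralWithUnitLead (q ∘P F) (d ℕ.* E)
  IntegralWithUnitLead-∘P {q} {F} {d} {E} 1≤E Q F* = record
    { degree   = LastMinimum⇒Deg (ByPosition.LastMinimum-∘P q 1≤E
                   (Deg⇒LastMinimum φ (-E≤0 E) (degree Q)) (Deg⇒LastMinimum -1ℤ -≤+ (degree F*)))
    ; unitLead = begin
        ν c
          ≡⟨ isolate (ν c) (+ d) (+ E) ⟩
        (+ 1 ℤ.* ν c ℤ.+ -1ℤ ℤ.* (+ d ℤ.* + E)) ℤ.+ + d ℤ.* + E
          ≡⟨ cong (λ k → + 1 ℤ.* ν c ℤ.+ -1ℤ ℤ.* k ℤ.+ + d ℤ.* + E) (ℤ.pos-* d E) ⟨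
        Height.weight -1ℤ c (d ℕ.* E) ℤ.+ + d ℤ.* + E
          ≡⟨ cong (ℤ._+ + d ℤ.* + E) (Height.attained lead*) ⟩
        φ ℤ.* + d ℤ.+ + d ℤ.* + E
          ≡⟨ cancel (+ d) (+ E) ⟩
        + 0 ∎
    ; integral = Integrality.AllAtLeast-∘P q (integral Q) (integral F*)
    }
    where
    open ≡-Reasoning
    φ = -1ℤ ℤ.* + E
    c = coeff (q ∘P F) (d ℕ.* E)
    module ByPosition  = Composition p p-prime 0 φ -1ℤ
    module ByHeight    = Composition p p-prime 1 φ -1ℤ
    module Integrality = Composition p p-prime 1 (+ 0) (+ 0)
    lead* : Height.LastMinimum -1ℤ (q ∘P F) (φ ℤ.* + d) (d ℕ.* E)
    lead* = ByHeight.LastMinimum-∘P q 1≤E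
      (Integral⇒LastMinimum φ (-E≤0 E) (degree Q) (unitLead Q) (integral Q))
      (Integral⇒LastMinimum -1ℤ -≤+ (degree F*) (unitLead F*) (integral F*))
    isolate : ∀ v d E → v ≡ (+ 1 ℤ.* v ℤ.+ -1ℤ ℤ.* (d ℤ.* E)) ℤ.+ d ℤ.* E
    isolate = solve-∀
    cancel : ∀ d E → -1ℤ ℤ.* E ℤ.* d ℤ.+ d ℤ.* E ≡ + 0
    cancel = solve-∀

  -- The Newton polygon of q lies on or above the segment from (0 , r) to
  -- (d , 0).
  AboveSegment : ℕ → Poly → ℕ → Set
  AboveSegment r q d = WeightedValuation.AllAtLeast p p-prime d (+ r) q (+ r ℤ.* + d)

  module Stretch (r d E : ℕ) = Composition p p-prime (d ℕ.* E) (+ r ℤ.* + E) (+ r)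

  AboveSegment-stretch : ∀ {r q d} E → AboveSegment r q d → Stretch.Outer.AllAtLeast r d E q (+ r ℤ.* + (d ℕ.* E))
  AboveSegment-stretch {r} {q} {d} E q-above = Stretch.Outer.allAtLeast {r} {d} {E} stretched
    where
    module Q = WeightedValuation p p-prime d (+ r)
    dE≡ = ℤ.pos-* d E
    stretched : ∀ i → Stretch.Outer.AtLeast r d E (+ r ℤ.* + (d ℕ.* E)) (coeff q i) i
    stretched i with Q.atLeast q-above i
    ... | inj₁ qᵢ≡0 = inj₁ qᵢ≡0
    ... | inj₂ rd≤w = inj₂ (subst₂ _≤_
      (trans (lhs (+ r) (+ d) (+ E)) (cong (+ r ℤ.*_) (sym dE≡)))
      (trans (rhs (+ d) (+ E) (+ r) (ν (coeff q i)) (+ i))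
             (cong (λ k → k ℤ.* ν (coeff q i) ℤ.+ + r ℤ.* + E ℤ.* + i) (sym dE≡)))
      (ℤ.*-monoˡ-≤-nonNeg (+ E) rd≤w))
      where
      lhs : ∀ r d E → E ℤ.* (r ℤ.* d) ≡ r ℤ.* (d ℤ.* E)
      lhs = solve-∀
      rhs : ∀ d E r v i → E ℤ.* (d ℤ.* v ℤ.+ r ℤ.* i) ≡ d ℤ.* E ℤ.* v ℤ.+ r ℤ.* E ℤ.* i
      rhs = solve-∀

  -- A segment from (0 , s) to (E , 0) with s d ≥ r also lies above the
  -- flatter one from (0 , r / d) to (E , 0).
  AboveSegment-flatten : ∀ {r s F E} d → r ℕ.≤ s ℕ.* d → AboveSegment s F E → Deg F E →
                         Stretch.Inner.AllAtLeast r d E F (+ r ℤ.* + E)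
  AboveSegment-flatten {r} {s} {F} {E} d r≤sd F-above (_ , F>E≡0) = Stretch.Inner.allAtLeast {r} {d} {E} flattened
    where
    module S = WeightedValuation p p-prime E (+ s)
    flattened : ∀ i → Stretch.Inner.AtLeast r d E (+ r ℤ.* + E) (coeff F i) i
    flattened i with i ℕ.≤? E | S.atLeast F-above i
    ... | no  i≰E | _          = inj₁ (F>E≡0 i (ℕ.≰⇒> i≰E))
    ... | yes _   | inj₁ Fᵢ≡0  = inj₁ Fᵢ≡0
    ... | yes i≤E | inj₂ sE≤w  = inj₂
      (subst (λ k → + r ℤ.* + E ≤ k ℤ.* ν (coeff F i) ℤ.+ + r ℤ.* + i) (sym (ℤ.pos-* d E))
        (ℤ.0≤i-j⇒j≤i (subst (+ 0 ≤_) (difference (+ d) (+ E) (+ s) (+ r) (ν (coeff F i)) (+ i))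
          (ℤ.+-mono-≤ (0≤i⇒0≤j⇒0≤i*j {+ d} (+≤+ ℕ.z≤n) (ℤ.i≤j⇒0≤j-i sE≤w))
                      (0≤i⇒0≤j⇒0≤i*j (ℤ.i≤j⇒0≤j-i (subst (+ r ≤_) (ℤ.pos-* s d) (+≤+ r≤sd)))
                                     (ℤ.i≤j⇒0≤j-i (+≤+ i≤E)))))))
      where
      difference : ∀ d E s r v i → d ℤ.* ((E ℤ.* v ℤ.+ s ℤ.* i) ℤ.- s ℤ.* E) ℤ.+ (s ℤ.* d ℤ.- r) ℤ.* (E ℤ.- i)
                                   ≡ (d ℤ.* E ℤ.* v ℤ.+ r ℤ.* i) ℤ.- r ℤ.* E
      difference = solve-∀

  AboveSegment-∘P : ∀ {r s q F d E} → r ℕ.≤ s ℕ.* d → AboveSegment r q d → AboveSegment s F E → Deg F E →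
                    AboveSegment r (q ∘P F) (d ℕ.* E)
  AboveSegment-∘P {r} {q = q} {d = d} {E} r≤sd q-above F-above deg-F =
    Stretch.AllAtLeast-∘P r d E q (AboveSegment-stretch E q-above) (AboveSegment-flatten d r≤sd F-above deg-F)

  -- The p^s-Dumas shape without the exact valuation of the constant term and
  -- without the gcd condition: this is what survives iteration of f.
  record WeaklyDumas (s : ℕ) (F : Poly) (E : ℕ) : Set where
    field
      shape        : IntegralWithUnitLead F E
      aboveSegment : AboveSegment s F E
      positive     : 1 ℕ.≤ E
  open WeaklyDumas public

  WeaklyDumas-∘P : ∀ {s q F d E} → WeaklyDumas s q d → WeaklyDumas s F E → WeaklyDumas s (q ∘P F) (d ℕ.* E)
  WeaklyDumas-∘P {s} {d = d} Q F* = record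
    { shape        = IntegralWithUnitLead-∘P (positive F*) (shape Q) (shape F*)
    ; aboveSegment = AboveSegment-∘P (ℕ.m≤m*n s d {{ℕ.>-nonZero (positive Q)}})
                                     (aboveSegment Q) (aboveSegment F*) (degree (shape F*))
    ; positive     = ℕ.*-mono-≤ (positive Q) (positive F*)
    }

  WeaklyDumas-intro : ∀ {s F E} → 1 ℕ.≤ E → Deg F E → ν (coeff F E) ≡ + 0 →
                      (∀ i → i ℕ.< E → coeff F i ≡ 0ℚ ⊎ + s ≤ ν (coeff F i)) → WeaklyDumas s F E
  WeaklyDumas-intro {s} {F} {E} 1≤E deg-F ν[F_E]≡0 lower = record
    { shape        = record { degree = deg-F ; unitLead = ν[F_E]≡0 ; integral = ν≥0⇒Integral F-integral }
    ; aboveSegment = Segment.allAtLeast F-above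
    ; positive     = 1≤E
    }
    where
    module Segment = WeightedValuation p p-prime E (+ s)
    F-integral : ∀ i → coeff F i ≡ 0ℚ ⊎ + 0 ≤ ν (coeff F i)
    F-integral i with ℕ.<-cmp i E
    ... | tri> _ _ E<i  = inj₁ (proj₂ deg-F i E<i)
    ... | tri≈ _ refl _ = inj₂ (ℤ.≤-reflexive (sym ν[F_E]≡0))
    ... | tri< i<E _ _ with lower i i<E
    ...   | inj₁ Fᵢ≡0 = inj₁ Fᵢ≡0
    ...   | inj₂ s≤ν  = inj₂ (ℤ.≤-trans (+≤+ ℕ.z≤n) s≤ν)
    F-above : ∀ i → Segment.AtLeast (+ s ℤ.* + E) (coeff F i) i
    F-above i with ℕ.<-cmp i E
    ... | tri> _ _ E<i  = inj₁ (proj₂ deg-F i E<i)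
    ... | tri≈ _ refl _ = inj₂ (ℤ.≤-reflexive (sym (trans (cong (λ v → + E ℤ.* v ℤ.+ + s ℤ.* + E) ν[F_E]≡0)
                                                           (trans (cong (ℤ._+ + s ℤ.* + E) (ℤ.*-zeroʳ (+ E)))
                                                                  (ℤ.+-identityˡ _)))))
    ... | tri< i<E _ _ with lower i i<E
    ...   | inj₁ Fᵢ≡0 = inj₁ Fᵢ≡0
    ...   | inj₂ s≤ν  = inj₂ (begin
      + s ℤ.* + E                            ≡⟨ ℤ.*-comm (+ s) (+ E) ⟩
      + E ℤ.* + s                            ≤⟨ ℤ.*-monoˡ-≤-nonNeg (+ E) s≤ν ⟩
      + E ℤ.* ν (coeff F i)                  ≤⟨ ℤ.i≤i+j _ (+ s ℤ.* + i) {{ℤ.nonNegative s·i≥0}} ⟩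
      + E ℤ.* ν (coeff F i) ℤ.+ + s ℤ.* + i  ∎)
      where
      open ℤ.≤-Reasoning
      s·i≥0 : + 0 ≤ + s ℤ.* + i
      s·i≥0 = 0≤i⇒0≤j⇒0≤i*j {+ s} (+≤+ ℕ.z≤n) (+≤+ ℕ.z≤n)

module DumasCriterion (p : ℕ) (p-prime : Prime p) where

  open import Defs
  open PolynomialAlgebra
  open Valuation p p-prime
  open Degree p p-prime
  open Composites p p-prime
  open import Data.Nat as ℕ using (zero; suc)
  import Data.Nat.Properties as ℕ
  open import Data.Nat.Divisibility as ℕ using (divides)
  open import Data.Nat.Coprimality using (Coprime; coprime-divisor; gcd≡1⇒coprime; coprime⇒gcd≡1; 1-coprimeTo)
  import Data.Nat.Coprimality as Coprimality
  open import Data.Nat.GCD using (gcd; gcd[0,0]≡0)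
  open import Data.Integer as ℤ using (ℤ; +_; _≤_; +≤+; +<+)
  import Data.Integer.Properties as ℤ
  import Data.Integer.Divisibility.Signed as ℤ
  open import Data.Integer.Tactic.RingSolver using (solve-∀)
  open IntegerArithmetic using (0≤i⇒0≤j⇒0≤i*j)
  open import Data.Rational as ℚ using (ℚ; 0ℚ)
  import Data.Rational.Properties as ℚ
  open import Data.List using ([]; _∷_)
  open import Data.Product using (Σ; _×_; _,_; proj₁; proj₂)
  open import Data.Sum using (_⊎_; inj₁; inj₂)
  open import Data.Empty using (⊥-elim)
  open import Relation.Nullary using (¬_; yes; no)
  open import Relation.Binary using (tri<; tri≈; tri>)
  open import Relation.Binary.PropositionalEquality

  private
    rd≡r[d∸i]+ri : ∀ r d i → i ℕ.≤ d → + r ℤ.* + d ≡ + (r ℕ.* (d ℕ.∸ i)) ℤ.+ + r ℤ.* + i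
    rd≡r[d∸i]+ri r d i i≤d = begin
      + r ℤ.* + d                           ≡⟨ ℤ.pos-* r d ⟨
      + (r ℕ.* d)                           ≡⟨ cong (λ k → + (r ℕ.* k)) (ℕ.m∸n+n≡m i≤d) ⟨
      + (r ℕ.* (d ℕ.∸ i ℕ.+ i))             ≡⟨ cong +_ (ℕ.*-distribˡ-+ r (d ℕ.∸ i) i) ⟩
      + (r ℕ.* (d ℕ.∸ i) ℕ.+ r ℕ.* i)       ≡⟨ ℤ.pos-+ (r ℕ.* (d ℕ.∸ i)) (r ℕ.* i) ⟩
      + (r ℕ.* (d ℕ.∸ i)) ℤ.+ + (r ℕ.* i)   ≡⟨ cong (λ z → + (r ℕ.* (d ℕ.∸ i)) ℤ.+ z) (ℤ.pos-* r i) ⟩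
      + (r ℕ.* (d ℕ.∸ i)) ℤ.+ + r ℤ.* + i   ∎
      where open ≡-Reasoning

  Dumas-slope⇒weight : ∀ r d i v → i ℕ.≤ d →
                       + (r ℕ.* (d ℕ.∸ i)) ≤ + d ℤ.* v → + r ℤ.* + d ≤ + d ℤ.* v ℤ.+ + r ℤ.* + i
  Dumas-slope⇒weight r d i v i≤d slope =
    subst (_≤ + d ℤ.* v ℤ.+ + r ℤ.* + i) (sym (rd≡r[d∸i]+ri r d i i≤d)) (ℤ.+-monoˡ-≤ (+ r ℤ.* + i) slope)

  weight⇒Dumas-slope : ∀ r d i v → i ℕ.≤ d →
                       + r ℤ.* + d ≤ + d ℤ.* v ℤ.+ + r ℤ.* + i → + (r ℕ.* (d ℕ.∸ i)) ≤ + d ℤ.* v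
  weight⇒Dumas-slope r d i v i≤d rd≤w = ℤ.0≤i-j⇒j≤i (subst (+ 0 ≤_) difference (ℤ.i≤j⇒0≤j-i rd≤w))
    where
    cancel : ∀ a b c → (a ℤ.+ b) ℤ.- (c ℤ.+ b) ≡ a ℤ.- c
    cancel = solve-∀
    difference : + d ℤ.* v ℤ.+ + r ℤ.* + i ℤ.- + r ℤ.* + d ≡ + d ℤ.* v ℤ.- + (r ℕ.* (d ℕ.∸ i))
    difference = trans (cong (λ z → + d ℤ.* v ℤ.+ + r ℤ.* + i ℤ.- z) (rd≡r[d∸i]+ri r d i i≤d))
                       (cancel (+ d ℤ.* v) (+ r ℤ.* + i) (+ (r ℕ.* (d ℕ.∸ i))))

  gcd≡1-* : ∀ {r d E} → gcd r d ≡ 1 → gcd r E ≡ 1 → gcd r (d ℕ.* E) ≡ 1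
  gcd≡1-* {r} {d} {E} gcd[r,d]≡1 gcd[r,E]≡1 = coprime⇒gcd≡1 {r} {d ℕ.* E} λ {k} (k∣r , k∣dE) →
    gcd≡1⇒coprime {r} {E} gcd[r,E]≡1 (k∣r , coprime-divisor {k} {d} {E} (k⊥d k∣r) k∣dE)
    where
    k⊥d : ∀ {k} → k ℕ.∣ r → Coprime k d
    k⊥d k∣r (j∣k , j∣d) = gcd≡1⇒coprime {r} {d} gcd[r,d]≡1 (ℕ.∣-trans j∣k k∣r , j∣d)

  private
    ∷-view : ∀ {u i} → coeff u i ≢ 0ℚ → Σ ℚ λ b → Σ Poly λ u' → u ≡ b ∷ u'
    ∷-view {[]}    []ᵢ≢0 = ⊥-elim ([]ᵢ≢0 refl)
    ∷-view {b ∷ u} _     = b , u , refl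

    -- d E (ν F₀ + ν Y₀) ≥ d E s + (r d E - r E) > r d E, because s d > r.
    constant-bound : ∀ {r s d E vF vY} → 1 ℕ.≤ E → r ℕ.< s ℕ.* d →
                     + s ℤ.* + E ≤ + E ℤ.* vF ℤ.+ + s ℤ.* + 0 →
                     + r ℤ.* + (d ℕ.* E) ℤ.- + r ℤ.* + E ≤ + (d ℕ.* E) ℤ.* vY ℤ.+ + r ℤ.* + 0 →
                     + r ℤ.< vF ℤ.+ vY
    constant-bound {r} {s} {d} {E} {vF} {vY} 1≤E r<sd sE≤wF w≤wY =
      ℤ.*-cancelˡ-<-nonNeg (+ (d ℕ.* E)) (subst₂ ℤ._<_ (cong (ℤ._* + r) (sym dE≡)) (cong (ℤ._* (vF ℤ.+ vY)) (sym dE≡))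
        (ℤ.suc[i]≤j⇒i<j (ℤ.0≤i-j⇒j≤i (subst (+ 0 ≤_) (difference (+ d) (+ E) (+ s) (+ r) vF vY)
          (ℤ.+-mono-≤ (ℤ.+-mono-≤ (0≤i⇒0≤j⇒0≤i*j {+ d} (+≤+ ℕ.z≤n) (ℤ.i≤j⇒0≤j-i sE≤wF))
                                  (ℤ.i≤j⇒0≤j-i w≤wY'))
                      (ℤ.+-mono-≤ (ℤ.+-mono-≤ (0≤i⇒0≤j⇒0≤i*j E-1≥0 x-1≥0) E-1≥0) x-1≥0))))))
      where
      dE≡ = ℤ.pos-* d E
      w≤wY' : + r ℤ.* (+ d ℤ.* + E) ℤ.- + r ℤ.* + E ≤ + d ℤ.* + E ℤ.* vY ℤ.+ + r ℤ.* + 0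
      w≤wY' = subst (λ D → + r ℤ.* D ℤ.- + r ℤ.* + E ≤ D ℤ.* vY ℤ.+ + r ℤ.* + 0) dE≡ w≤wY
      E-1≥0 : + 0 ≤ + E ℤ.- + 1
      E-1≥0 = ℤ.i≤j⇒0≤j-i (+≤+ 1≤E)
      x-1≥0 : + 0 ≤ (+ s ℤ.* + d ℤ.- + r) ℤ.- + 1
      x-1≥0 = subst (+ 0 ≤_) (trans (cong₂ ℤ._-_ (ℤ.pos-* s d) (ℤ.pos-+ 1 r)) (regroup (+ s ℤ.* + d) (+ r)))
                             (ℤ.i≤j⇒0≤j-i (+≤+ r<sd))
        where
        regroup : ∀ a r → a ℤ.- (+ 1 ℤ.+ r) ≡ (a ℤ.- r) ℤ.- + 1
        regroup = solve-∀
      difference : ∀ d E s r vF vY →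
        (d ℤ.* ((E ℤ.* vF ℤ.+ s ℤ.* + 0) ℤ.- s ℤ.* E)
          ℤ.+ ((d ℤ.* E ℤ.* vY ℤ.+ r ℤ.* + 0) ℤ.- (r ℤ.* (d ℤ.* E) ℤ.- r ℤ.* E)))
        ℤ.+ ((E ℤ.- + 1) ℤ.* ((s ℤ.* d ℤ.- r) ℤ.- + 1) ℤ.+ (E ℤ.- + 1) ℤ.+ ((s ℤ.* d ℤ.- r) ℤ.- + 1))
        ≡ d ℤ.* E ℤ.* (vF ℤ.+ vY) ℤ.- (+ 1 ℤ.+ d ℤ.* E ℤ.* r)
      difference = solve-∀


    -- The constant term of (b ∷ q') ∘ F is b + F₀ (q' ∘ F)₀, and the second
    -- summand has valuation > r = ν b.
    constant-∘P : ∀ {r s d E b q' F} → 1 ℕ.≤ E → r ℕ.< s ℕ.* d → b ≢ 0ℚ → ν b ≡ + r →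
                  Stretch.Outer.AllAtLeast r d E q' (+ r ℤ.* + (d ℕ.* E) ℤ.- + r ℤ.* + E) →
                  AboveSegment s F E → Deg F E → Val p (coeff ((b ∷ q') ∘P F) 0) (+ r)
    constant-∘P {r} {s} {d} {E} {b} {q'} {F} 1≤E r<sd b≢0 νb≡r q'-above F-above deg-F =
      subst (λ z → Val p z (+ r)) (sym (coeff-∘P-0 b q' F))
            (subst (Val p (b ℚ.+ y)) (trans (proj₂ dominant) νb≡r) (ν⇒Val (proj₁ dominant)))
      where
      module S = WeightedValuation p p-prime E (+ s)
      module Inner = Stretch.Inner r d E
      Y = q' ∘P F
      y = coeff F 0 ℚ.* coeff Y 0
      Y-above : Inner.AllAtLeast Y (+ r ℤ.* + (d ℕ.* E) ℤ.- + r ℤ.* + E)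
      Y-above = Stretch.AllAtLeast-∘P r d E q' q'-above (AboveSegment-flatten d (ℕ.<⇒≤ r<sd) F-above deg-F)
      y-negligible : y ≡ 0ℚ ⊎ ν b ℤ.< ν y
      y-negligible with coeff F 0 ℚ.≟ 0ℚ | coeff Y 0 ℚ.≟ 0ℚ
      ... | yes F₀≡0 | _        = inj₁ (trans (cong (ℚ._* coeff Y 0) F₀≡0) (ℚ.*-zeroˡ (coeff Y 0)))
      ... | no _     | yes Y₀≡0 = inj₁ (trans (cong (coeff F 0 ℚ.*_) Y₀≡0) (ℚ.*-zeroʳ (coeff F 0)))
      ... | no F₀≢0  | no Y₀≢0  = inj₂ (subst₂ ℤ._<_ (sym νb≡r) (sym (proj₂ (ν-* F₀≢0 Y₀≢0)))
        (constant-bound {r} {s} {d} {E} 1≤E r<sd (S.AtLeast⇒≤ (S.atLeast F-above 0) F₀≢0)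
                                                (Inner.AtLeast⇒≤ (Inner.atLeast Y-above 0) Y₀≢0)))
      dominant = ν-+-dominant b≢0 y-negligible

  module _ {r q} (D : Dumas p r q) where

    private
      d = proj₁ D
      deg-q = proj₁ (proj₂ D)
      ν[b_d]≡0 = sym (Val⇒ν (proj₁ (proj₂ (proj₂ D))))
      val-b₀ = proj₁ (proj₂ (proj₂ (proj₂ D)))
      ν[b₀]≡r = sym (Val⇒ν val-b₀)
      slope-condition = proj₁ (proj₂ (proj₂ (proj₂ (proj₂ D))))
      gcd[r,d]≡1 = proj₂ (proj₂ (proj₂ (proj₂ (proj₂ D))))

    module DumasWeight = WeightedValuation p p-prime d (+ r)
    open DumasWeight using (FirstMinimum; LastMinimum; AtLeast; minimum; allAtLeast)

    private
      weight[b₀]≡rd : DumasWeight.weight (coeff q 0) 0 ≡ + r ℤ.* + d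
      weight[b₀]≡rd = trans (cong (λ v → + d ℤ.* v ℤ.+ + r ℤ.* + 0) ν[b₀]≡r) (regroup (+ r) (+ d))
        where
        regroup : ∀ r d → d ℤ.* r ℤ.+ r ℤ.* + 0 ≡ r ℤ.* d
        regroup = solve-∀

      weight[b_d]≡rd : DumasWeight.weight (coeff q d) d ≡ + r ℤ.* + d
      weight[b_d]≡rd = trans (cong (λ v → + d ℤ.* v ℤ.+ + r ℤ.* + d) ν[b_d]≡0) (regroup (+ r) (+ d))
        where
        regroup : ∀ r d → d ℤ.* + 0 ℤ.+ r ℤ.* d ≡ r ℤ.* d
        regroup = solve-∀

      Dumas-AtLeast : ∀ i → AtLeast (+ r ℤ.* + d) (coeff q i) i
      Dumas-AtLeast zero = inj₂ (ℤ.≤-reflexive (sym weight[b₀]≡rd))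
      Dumas-AtLeast (suc i) with ℕ.<-cmp (suc i) d
      ... | tri> _ _ d<i = inj₁ (proj₂ deg-q (suc i) d<i)
      ... | tri≈ _ refl _ = inj₂ (ℤ.≤-reflexive (sym weight[b_d]≡rd))
      ... | tri< i<d _ _ with slope-condition (suc i) (ℕ.s≤s ℕ.z≤n) i<d
      ...   | inj₁ b_i≡0 = inj₁ b_i≡0
      ...   | inj₂ (v , val-b_i , slope) =
        inj₂ (subst (λ w → + r ℤ.* + d ≤ + d ℤ.* w ℤ.+ + r ℤ.* + suc i) (Val⇒ν val-b_i)
                    (Dumas-slope⇒weight r d (suc i) v (ℕ.<⇒≤ i<d) slope))

    Dumas⇒AboveSegment : AboveSegment r q d
    Dumas⇒AboveSegment = allAtLeast Dumas-AtLeast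

    Dumas-FirstMinimum : FirstMinimum q (+ r ℤ.* + d) 0
    Dumas-FirstMinimum = minimum Dumas⇒AboveSegment (proj₁ val-b₀) weight[b₀]≡rd (λ _ ())

    Dumas-LastMinimum : LastMinimum q (+ r ℤ.* + d) d
    Dumas-LastMinimum = minimum Dumas⇒AboveSegment (proj₁ deg-q) weight[b_d]≡rd
      (λ i d<i → inj₁ (proj₂ deg-q i d<i))

    -- A factor u of q has its (d , r)-minimisers at 0 and at j, so
    -- d ν(u₀) = d ν(uⱼ) + r j and d ∣ r j; as gcd(r, d) = 1, d ∣ j.
    lastMinimiser-divisible : ∀ {u m j} → FirstMinimum u m 0 → LastMinimum u m j → d ℕ.∣ j
    lastMinimiser-divisible {u} {m} {j} U U' =
      coprime-divisor {d} {r} {j} (Coprimality.sym (gcd≡1⇒coprime {r} {d} gcd[r,d]≡1))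
        (ℤ.∣⇒∣ᵤ (ℤ.divides (A ℤ.- B) rj≡[A-B]d))
      where
      A = ν (coeff u 0)
      B = ν (coeff u j)
      rj≡[A-B]d : + (r ℕ.* j) ≡ (A ℤ.- B) ℤ.* + d
      rj≡[A-B]d = begin
        + (r ℕ.* j)                                     ≡⟨ ℤ.pos-* r j ⟩
        + r ℤ.* + j                                     ≡⟨ isolate (+ r ℤ.* + j) B (+ d) ⟩
        (+ d ℤ.* B ℤ.+ + r ℤ.* + j) ℤ.- + d ℤ.* B       ≡⟨ cong (ℤ._- + d ℤ.* B) (trans (DumasWeight.attained U')
                                                                                      (sym (DumasWeight.attained U))) ⟩
        (+ d ℤ.* A ℤ.+ + r ℤ.* + 0) ℤ.- + d ℤ.* B       ≡⟨ collect A B (+ d) (+ r) ⟩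
        (A ℤ.- B) ℤ.* + d                               ∎
        where
        open ≡-Reasoning
        isolate : ∀ x B d → x ≡ (d ℤ.* B ℤ.+ x) ℤ.- d ℤ.* B
        isolate = solve-∀
        collect : ∀ A B d r → (d ℤ.* A ℤ.+ r ℤ.* + 0) ℤ.- d ℤ.* B ≡ (A ℤ.- B) ℤ.* d
        collect = solve-∀

    private
      1≤d : 1 ℕ.≤ d
      1≤d with d in d≡
      ... | suc _ = ℕ.s≤s ℕ.z≤n
      ... | zero  = ⊥-elim (0≢1 (trans (sym gcd[0,0]≡0) (subst₂ (λ a b → gcd a b ≡ 1) r≡0 d≡ gcd[r,d]≡1)))
        where
        0≢1 : 0 ≢ 1
        0≢1 ()
        -- for d = 0 the leading and constant coefficient coincide
        r≡0 : r ≡ 0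
        r≡0 = ℤ.+-injective (trans (sym ν[b₀]≡r) (subst (λ k → ν (coeff q k) ≡ + 0) d≡ ν[b_d]≡0))

      q≉[] : ¬ (q ≋ [])
      q≉[] q≋[] = proj₁ deg-q (coeff-≡ q≋[] d)

      bounded-summands-equal : ∀ {a b c e} → a ℕ.≤ c → b ℕ.≤ e → a ℕ.+ b ≡ c ℕ.+ e → a ≡ c
      bounded-summands-equal {a} {b} {c} {e} a≤c b≤e a+b≡c+e with ℕ.m≤n⇒m<n∨m≡n a≤c
      ... | inj₂ a≡c = a≡c
      ... | inj₁ a<c = ⊥-elim (ℕ.<-irrefl a+b≡c+e (ℕ.+-mono-<-≤ a<c b≤e))

    -- In a factorisation q = u w the last (d , r)-minimisers of u and w add
    -- up to d, as do their degrees; each minimiser is at most the degree, so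
    -- the minimiser of u is its degree, which is then divisible by d.
    factor-degrees : ∀ u w → q ≋ u *P w →
                     Σ ℕ λ Ku → Σ ℕ λ Kw → Deg u Ku × Deg w Kw × Ku ℕ.+ Kw ≡ d × d ℕ.∣ Ku
    factor-degrees u w q≋uw = Ku , Kw , deg-u , deg-w , Ku+Kw≡d , subst (d ℕ.∣_) ju≡Ku d∣ju
      where
      u≉[] : ¬ (u ≋ [])
      u≉[] u≋[] = q≉[] (≋-trans q≋uw (*P-zeroˡ w u≋[]))
      w≉[] : ¬ (w ≋ [])
      w≉[] w≋[] = q≉[] (≋-trans q≋uw (≋-trans (*P-congʳ u w≋[]) (*P-zeroʳ u)))
      Ku = proj₁ (Deg-exists u u≉[])
      Kw = proj₁ (Deg-exists w w≉[])
      deg-u = proj₂ (Deg-exists u u≉[])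
      deg-w = proj₂ (Deg-exists w w≉[])
      Ku+Kw≡d : Ku ℕ.+ Kw ≡ d
      Ku+Kw≡d = Deg-unique {q} (Deg-cong {u *P w} (≋-sym q≋uw) (Deg-*P {u} {w} deg-u deg-w)) deg-q
      open DumasWeight.Minimisers (DumasWeight.minimisersOf u u≉[])
        renaming (firstIndex to iu; lastIndex to ju; isFirst to U; isLast to U')
      open DumasWeight.Minimisers (DumasWeight.minimisersOf w w≉[])
        renaming (firstIndex to iw; lastIndex to jw; isFirst to W; isLast to W')
      iu+iw≡0 : iu ℕ.+ iw ≡ 0
      iu+iw≡0 = DumasWeight.Minimum-index-unique
        (DumasWeight.Minimum-cong (≋-sym q≋uw) (DumasWeight.FirstMinimum-*P u U W)) Dumas-FirstMinimum
      ju+jw≡d : ju ℕ.+ jw ≡ d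
      ju+jw≡d = DumasWeight.Minimum-index-unique
        (DumasWeight.Minimum-cong (≋-sym q≋uw) (DumasWeight.LastMinimum-*P u U' W')) Dumas-LastMinimum
      d∣ju : d ℕ.∣ ju
      d∣ju = lastMinimiser-divisible (subst (FirstMinimum u _) (ℕ.m+n≡0⇒m≡0 iu iu+iw≡0) U) U'
      ju≡Ku : ju ≡ Ku
      ju≡Ku = bounded-summands-equal (Deg⇒≤ {u} deg-u (DumasWeight.nonzero U')) (Deg⇒≤ {w} deg-w (DumasWeight.nonzero W'))
                                     (trans ju+jw≡d (sym Ku+Kw≡d))

    Dumas-factor : ∀ u w → q ≋ u *P w → IsConstant u ⊎ IsConstant w
    Dumas-factor u w q≋uw = zero-or-d (factor-degrees u w q≋uw)
      where
      zero-or-d : (Σ ℕ λ Ku → Σ ℕ λ Kw → Deg u Ku × Deg w Kw × Ku ℕ.+ Kw ≡ d × d ℕ.∣ Ku) →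
                  IsConstant u ⊎ IsConstant w
      zero-or-d (zero  , _  , deg-u , _     , _        , _)     = inj₁ (Deg0⇒IsConstant {u} deg-u)
      zero-or-d (suc k , Kw , _     , deg-w , 1+k+Kw≡d , d∣1+k) = inj₂ (Deg0⇒IsConstant {w} (subst (Deg w) Kw≡0 deg-w))
        where
        1+k≡d : suc k ≡ d
        1+k≡d = ℕ.≤-antisym (subst (suc k ℕ.≤_) 1+k+Kw≡d (ℕ.m≤m+n (suc k) Kw)) (ℕ.∣⇒≤ d∣1+k)
        Kw≡0 : Kw ≡ 0
        Kw≡0 = ℕ.+-cancelˡ-≡ (suc k) Kw 0 (trans 1+k+Kw≡d (trans (sym 1+k≡d) (sym (ℕ.+-identityʳ (suc k)))))

    Dumas⇒Irreducible : Irreducible q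
    Dumas⇒Irreducible = (d , deg-q , 1≤d) , λ u w q≈uw → Dumas-factor u w ⟪ q≈uw ⟫

    Dumas⇒IntegralWithUnitLead : IntegralWithUnitLead q d
    Dumas⇒IntegralWithUnitLead = record { degree = deg-q ; unitLead = ν[b_d]≡0 ; integral = ν≥0⇒Integral ν≥0 }
      where
      instance
        d-positive : ℤ.Positive (+ d)
        d-positive = ℤ.positive (+<+ 1≤d)
      ν≥0 : ∀ i → coeff q i ≡ 0ℚ ⊎ + 0 ≤ ν (coeff q i)
      ν≥0 i with i ℕ.≤? d | Dumas-AtLeast i
      ... | no  i≰d | _          = inj₁ (proj₂ deg-q i (ℕ.≰⇒> i≰d))
      ... | yes _   | inj₁ bᵢ≡0  = inj₁ bᵢ≡0
      ... | yes i≤d | inj₂ rd≤w  = inj₂ (ℤ.*-cancelˡ-≤-pos (+ 0) (ν (coeff q i)) (+ d)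
        (subst (_≤ + d ℤ.* ν (coeff q i)) (sym (ℤ.*-zeroʳ (+ d)))
               (ℤ.≤-trans (+≤+ ℕ.z≤n) (weight⇒Dumas-slope r d i (ν (coeff q i)) i≤d rd≤w))))

    Dumas-∘P : ∀ {s F E} → r ℕ.< s ℕ.* d → WeaklyDumas s F E → gcd r E ≡ 1 → Dumas p r (q ∘P F)
    Dumas-∘P {s} {F} {E} r<sd F* gcd[r,E]≡1 =
      d ℕ.* E , degree QF , lead , constant , middle , gcd≡1-* {r} {d} {E} gcd[r,d]≡1 gcd[r,E]≡1
      where
      module Segment = WeightedValuation p p-prime (d ℕ.* E) (+ r)
      QF = IntegralWithUnitLead-∘P (positive F*) Dumas⇒IntegralWithUnitLead (shape F*)
      lead : Val p (coeff (q ∘P F) (d ℕ.* E)) (+ 0)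
      lead = subst (Val p (coeff (q ∘P F) (d ℕ.* E))) (unitLead QF) (ν⇒Val (proj₁ (degree QF)))
      QF-above : AboveSegment r (q ∘P F) (d ℕ.* E)
      QF-above = AboveSegment-∘P (ℕ.<⇒≤ r<sd) Dumas⇒AboveSegment (aboveSegment F*) (degree (shape F*))
      middle : ∀ i → 1 ℕ.≤ i → i ℕ.< d ℕ.* E → coeff (q ∘P F) i ≡ 0ℚ ⊎
               Σ ℤ λ v → Val p (coeff (q ∘P F) i) v × + (r ℕ.* (d ℕ.* E ℕ.∸ i)) ≤ + (d ℕ.* E) ℤ.* v
      middle i _ i<dE with coeff (q ∘P F) i ℚ.≟ 0ℚ | Segment.atLeast QF-above i
      ... | yes cᵢ≡0 | _          = inj₁ cᵢ≡0
      ... | no _     | inj₁ cᵢ≡0  = inj₁ cᵢ≡0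
      ... | no cᵢ≢0  | inj₂ rdE≤w = inj₂ (ν (coeff (q ∘P F) i) , ν⇒Val cᵢ≢0 ,
                                         weight⇒Dumas-slope r (d ℕ.* E) i _ (ℕ.<⇒≤ i<dE) rdE≤w)
      constant : Val p (coeff (q ∘P F) 0) (+ r)
      constant with ∷-view {q} (proj₁ val-b₀)
      ... | b , q' , refl = constant-∘P (positive F*) r<sd (proj₁ val-b₀) ν[b₀]≡r
        (Stretch.Outer.AllAtLeast-tail r d E (AboveSegment-stretch E Dumas⇒AboveSegment))
        (aboveSegment F*) (degree (shape F*))

  gcd≡1-^ : ∀ {r e} → gcd r e ≡ 1 → ∀ m → gcd r (e ℕ.^ m) ≡ 1
  gcd≡1-^ {r} _         zero    = coprime⇒gcd≡1 {r} {1} (Coprimality.sym (1-coprimeTo r))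
  gcd≡1-^ {r} {e} gcd[r,e]≡1 (suc m) = gcd≡1-* {r} {e} gcd[r,e]≡1 (gcd≡1-^ {r} {e} gcd[r,e]≡1 m)

module Iterates (p : ℕ) (p-prime : Prime p) (a : ℚ) (e s : ℕ) (h : Poly)
                  (1≤e : 1 ℕ.≤ e) (val-a : Val p a (+ 0)) (deg-h<e : DegLt h e) (h-integral : PolyValNonneg p h) where

  open PolynomialAlgebra
  open Valuation p p-prime
  open Composites p p-prime
  open import Data.Nat using (zero; suc)
  import Data.Nat.Properties as ℕ
  open import Data.Integer as ℤ using (_≤_)
  import Data.Integer.Properties as ℤ
  open import Data.Rational as ℚ using (0ℚ)
  import Data.Rational.Properties as ℚ
  open import Data.Product using (_,_; proj₁; proj₂)
  open import Data.Sum using (_⊎_; inj₁; inj₂)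
  open import Relation.Nullary using (yes; no)
  open import Relation.Binary.PropositionalEquality

  f : Poly
  f = fPoly p a e s h

  private
    pˢ = powQ p s

    coeff-f : ∀ i → coeff f i ≡ coeff (monomial a e) i ℚ.+ pˢ ℚ.* coeff h i
    coeff-f i = trans (coeff-+P (monomial a e) (scale pˢ h) i) (cong (coeff (monomial a e) i ℚ.+_) (coeff-scale pˢ h i))

    pˢhᵢ≡0 : ∀ i → e ℕ.≤ i → pˢ ℚ.* coeff h i ≡ 0ℚ
    pˢhᵢ≡0 i e≤i = trans (cong (pˢ ℚ.*_) (deg-h<e i e≤i)) (ℚ.*-zeroʳ pˢ)

    coeff-f-e : coeff f e ≡ a
    coeff-f-e = trans (coeff-f e) (trans (cong₂ ℚ._+_ (coeff-monomial-≡ a e) (pˢhᵢ≡0 e ℕ.≤-refl)) (ℚ.+-identityʳ a))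

    coeff-f-> : ∀ i → e ℕ.< i → coeff f i ≡ 0ℚ
    coeff-f-> i e<i = trans (coeff-f i)
      (trans (cong₂ ℚ._+_ (coeff-monomial-> a e i e<i) (pˢhᵢ≡0 i (ℕ.<⇒≤ e<i))) (ℚ.+-identityˡ 0ℚ))

    coeff-f-< : ∀ i → i ℕ.< e → coeff f i ≡ pˢ ℚ.* coeff h i
    coeff-f-< i i<e = trans (coeff-f i)
      (trans (cong (ℚ._+ pˢ ℚ.* coeff h i) (coeff-monomial-< a e i i<e)) (ℚ.+-identityˡ (pˢ ℚ.* coeff h i)))

    ν[fₑ]≡0 : ν (coeff f e) ≡ + 0
    ν[fₑ]≡0 = trans (cong ν coeff-f-e) (sym (Val⇒ν val-a))

    lower-coefficients : ∀ i → i ℕ.< e → coeff f i ≡ 0ℚ ⊎ + s ≤ ν (coeff f i)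
    lower-coefficients i i<e with coeff h i ℚ.≟ 0ℚ
    ... | yes hᵢ≡0 = inj₁ (trans (coeff-f-< i i<e) (trans (cong (pˢ ℚ.*_) hᵢ≡0) (ℚ.*-zeroʳ pˢ)))
    ... | no  hᵢ≢0 with h-integral i
    ...   | inj₁ hᵢ≡0 = inj₁ (trans (coeff-f-< i i<e) (trans (cong (pˢ ℚ.*_) hᵢ≡0) (ℚ.*-zeroʳ pˢ)))
    ...   | inj₂ (v , val-hᵢ , 0≤v) = inj₂ (begin
      + s                          ≡⟨ ℤ.+-identityʳ (+ s) ⟨
      + s ℤ.+ + 0                  ≤⟨ ℤ.+-monoʳ-≤ (+ s) (subst (+ 0 ≤_) (Val⇒ν val-hᵢ) 0≤v) ⟩
      + s ℤ.+ ν (coeff h i)        ≡⟨ cong (ℤ._+ ν (coeff h i)) (proj₂ (ν-powQ s)) ⟨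
      ν pˢ ℤ.+ ν (coeff h i)       ≡⟨ proj₂ (ν-* (proj₁ (ν-powQ s)) hᵢ≢0) ⟨
      ν (pˢ ℚ.* coeff h i)         ≡⟨ cong ν (coeff-f-< i i<e) ⟨
      ν (coeff f i)                ∎)
      where open ℤ.≤-Reasoning

  WeaklyDumas-f : WeaklyDumas s f e
  WeaklyDumas-f = WeaklyDumas-intro 1≤e ((λ fₑ≡0 → proj₁ val-a (trans (sym coeff-f-e) fₑ≡0)) , coeff-f->)
                                    ν[fₑ]≡0 lower-coefficients

  WeaklyDumas-X : WeaklyDumas s X 1
  WeaklyDumas-X = WeaklyDumas-intro ℕ.≤-refl ((λ ()) , X>1≡0) ν-1 λ { zero _ → inj₁ refl ; (suc i) (ℕ.s≤s ()) }
    where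
    X>1≡0 : ∀ i → 1 ℕ.< i → coeff X i ≡ 0ℚ
    X>1≡0 (suc (suc i)) _ = refl
    X>1≡0 (suc zero) (ℕ.s≤s ())

  WeaklyDumas-iter : ∀ m → WeaklyDumas s (iter f m) (e ℕ.^ m)
  WeaklyDumas-iter zero    = WeaklyDumas-X
  WeaklyDumas-iter (suc m) = WeaklyDumas-∘P WeaklyDumas-f (WeaklyDumas-iter m)


open import Defs
open PolynomialAlgebra using (⟪_⟫; coeff-≡; iter-factorisation)
open import Data.Nat using (ℕ; _≤_; _<_; _*_; _∸_)
open import Data.Nat.Primality using (Prime)
open import Data.Nat.GCD using (gcd)
open import Data.Integer using (+_)
open import Data.Rational using (ℚ)
open import Data.Fin using (Fin)
open import Data.Product using (_×_; _,_; proj₁; proj₂)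
open import Relation.Binary.PropositionalEquality using (_≡_; subst)

corollary4p5 :
    (p : ℕ) → Prime p →
    (a : ℚ) (e s : ℕ) (h : Poly) →
    1 ≤ e → Val p a (+ 0) → DegLt h e → PolyValNonneg p h → 1 ≤ s →
    (n : ℕ) → 1 ≤ n →
    (t : ℕ) (g : Fin t → Poly) (d r : Fin t → ℕ) →
    iter (fPoly p a e s h) n ≈P prodP t g →
    (∀ i → Irreducible (g i) × Deg (g i) (d i) × 1 ≤ d i) →
    (∀ i → 1 ≤ r i × Dumas p (r i) (g i) × gcd (r i) e ≡ 1 × r i < s * d i) →
    (∀ i → Stable (fPoly p a e s h) (g i)) ×
    (∀ N → n ≤ N →
      (iter (fPoly p a e s h) N
         ≈P prodP t (λ i → g i ∘P iter (fPoly p a e s h) (N ∸ n))) ×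
      (∀ i → Irreducible (g i ∘P iter (fPoly p a e s h) (N ∸ n)) ×
             Dumas p (r i) (g i ∘P iter (fPoly p a e s h) (N ∸ n))))
corollary4p5 p p-prime a e s h 1≤e val-a deg-h h-integral _ n _ t g d r fⁿ≈∏g degrees conditions =
  (λ i m _ → irreducible i m) ,
  λ N n≤N → coeff-≡ (iter-factorisation {f} {t = t} {g} ⟪ fⁿ≈∏g ⟫ n≤N) ,
            λ i → irreducible i (N ∸ n) , dumas-∘-iter i (N ∸ n)
  where
  open DumasCriterion p p-prime
  open Iterates p p-prime a e s h 1≤e val-a deg-h h-integral
  dumas-∘-iter : ∀ i m → Dumas p (r i) (g i ∘P iter f m)
  dumas-∘-iter i m with conditions i | degrees i
  ... | _ , Dᵢ , gcd[rᵢ,e]≡1 , rᵢ<sdᵢ | _ , deg-gᵢ , _ = Dumas-∘P {q = g i} Dᵢ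
    (subst (λ k → r i < s * k) (Degree.Deg-unique p p-prime {g i} deg-gᵢ (proj₁ (proj₂ Dᵢ))) rᵢ<sdᵢ)
    (WeaklyDumas-iter m) (gcd≡1-^ {r i} {e} gcd[rᵢ,e]≡1 m)
  irreducible : ∀ i m → Irreducible (g i ∘P iter f m)
  irreducible i m = Dumas⇒Irreducible {q = g i ∘P iter f m} (dumas-∘-iter i m)
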